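{- Let $\mathbf{C}$ be an even snowflake with $M$ edges. If $M\equiv 0\pmod 4$ then $\mathbf{C}$ is conservative; otherwise $\mathbf{C}$ is near-conservative.
   Context: A snowflake is the tree obtained from a disjoint union of stars $S_1,\ldots,S_p$ ($S_i\cong K_{1,n_i}$, $n_i\geq 3$) by identifying one leaf of each star into a single vertex $z$, the center. An internal vertex is a vertex of degree at least $2$. A snowflake is even if every internal vertex other than possibly the center has even degree. A labeling of a graph $G$ is a bijection from $E(G)$ to a set of $|E(G)|$ positive integers. Given an orientation and a labeling $\phi$, the vertex-sum $s(u)$ is the sum of labels of arcs entering $u$ minus the sum of labels of arcs leaving $u$. For $G$ with $M$ edges, a conservative labeling is an (orientation, labeling) pair with label set $[1,M]=\{1,\ldots,M\}$ such that $s(u)=0$ at every vertex of degree at least $3$; a near-conservative labeling is the same with label set $[1,M-1]\cup\{M+1\}$. $G$ is conservative if it admits a conservative labeling, and near-conservative if it is not conservative but admits a near-conservative labeling. -}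

module Defs where

open import Data.Nat using (ℕ; zero; suc; _+_; _∸_; _≤_; _%_)
open import Data.Nat.Divisibility using (_∣_)
open import Data.Integer as ℤ using (ℤ; +_; _-_)
open import Data.Bool using (Bool; true; false; if_then_else_; _∨_)
open import Data.Fin using (Fin)
open import Data.List using (List; []; _∷_; length; map; concat; lookup; allFin; upTo)
open import Data.List.Relation.Unary.All using (All)
open import Data.Product using (Σ; _×_; _,_; proj₁; proj₂; ∃)
open import Data.Sum using (_⊎_)
open import Relation.Nullary using (¬_; does)
open import Relation.Binary.PropositionalEquality using (_≡_; _≢_; refl; cong)
open import Relation.Binary.Definitions using (DecidableEquality)
open import Function.Definitions using (Injective)

record Graph : Set₁ where
  field
    V     : Set
    _≟V_  : DecidableEquality V
    edges : List (V × V)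

  M : ℕ
  M = length edges

  Edge : Set
  Edge = Fin M

  ends : Edge → V × V
  ends e = lookup edges e

  ind : Bool → ℕ
  ind true  = 1
  ind false = 0

  sumℕ : List ℕ → ℕ
  sumℕ []       = 0
  sumℕ (x ∷ xs) = x + sumℕ xs

  sumℤ : List ℤ → ℤ
  sumℤ []       = + 0
  sumℤ (x ∷ xs) = x ℤ.+ sumℤ xs

  deg : V → ℕ
  deg u = sumℕ (map (λ e → ind (does (u ≟V proj₁ (ends e)) ∨ does (u ≟V proj₂ (ends e))))
                    (allFin M))

  -- An orientation: for every edge, true means the arc goes from the first
  -- listed endpoint to the second, false means the reverse.
  Orientation : Set
  Orientation = Edge → Bool

  tailOf headOf : Orientation → Edge → V
  tailOf o e = if o e then proj₁ (ends e) else proj₂ (ends e)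
  headOf o e = if o e then proj₂ (ends e) else proj₁ (ends e)

  vertexSum : Orientation → (Edge → ℕ) → V → ℤ
  vertexSum o lab u =
    sumℤ (map (λ e → + (ind (does (u ≟V headOf o e)) Data.Nat.* lab e)) (allFin M))
    - sumℤ (map (λ e → + (ind (does (u ≟V tailOf o e)) Data.Nat.* lab e)) (allFin M))

  IsLabelingOnto : (ℕ → Set) → (Edge → ℕ) → Set
  IsLabelingOnto S lab =
    Injective _≡_ _≡_ lab × (∀ e → S (lab e)) × (∀ k → S k → ∃ λ e → lab e ≡ k)

  ConsLabels : ℕ → Set
  ConsLabels k = 1 ≤ k × k ≤ M

  NearLabels : ℕ → Set
  NearLabels k = (1 ≤ k × k ≤ M ∸ 1) ⊎ k ≡ suc M

  ZeroSumLabeling : (ℕ → Set) → Set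
  ZeroSumLabeling S =
    Σ Orientation λ o → Σ (Edge → ℕ) λ lab →
      IsLabelingOnto S lab × (∀ u → 3 ≤ deg u → vertexSum o lab u ≡ + 0)

  Conservative : Set
  Conservative = ZeroSumLabeling ConsLabels

  NearConservative : Set
  NearConservative = ¬ Conservative × ZeroSumLabeling NearLabels

-- Given n₁,…,n_p (the list ns), the snowflake has the center
-- z, for each star i its center (hub i), and leaves (leaf i j),
-- j = 0,…,nᵢ-2.  Star i consists of the nᵢ edges  hub i — z  (z being the
-- identified leaf of Sᵢ) and  hub i — leaf i j.

data SV : Set where
  center : SV
  hub    : ℕ → SV
  leaf   : ℕ → ℕ → SV

hub-inj : ∀ {i j} → hub i ≡ hub j → i ≡ j
hub-inj refl = refl

leaf-inj₁ : ∀ {i j k l} → leaf i k ≡ leaf j l → i ≡ j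
leaf-inj₁ refl = refl

leaf-inj₂ : ∀ {i j k l} → leaf i k ≡ leaf j l → k ≡ l
leaf-inj₂ refl = refl

open import Relation.Nullary using (yes; no)
import Data.Nat.Properties as NP

_≟SV_ : DecidableEquality SV
center ≟SV center = yes refl
center ≟SV hub _ = no λ ()
center ≟SV leaf _ _ = no λ ()
hub _ ≟SV center = no λ ()
hub i ≟SV hub j with i NP.≟ j
... | yes refl = yes refl
... | no ne = no λ eq → ne (hub-inj eq)
hub _ ≟SV leaf _ _ = no λ ()
leaf _ _ ≟SV center = no λ ()
leaf _ _ ≟SV hub _ = no λ ()
leaf i k ≟SV leaf j l with i NP.≟ j | k NP.≟ l
... | yes refl | yes refl = yes refl
... | no ne | _ = no λ eq → ne (leaf-inj₁ eq)
... | _ | no ne = no λ eq → ne (leaf-inj₂ eq)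

starEdges : ℕ → ℕ → List (SV × SV)
starEdges i n = (center , hub i) ∷ map (λ j → (hub i , leaf i j)) (upTo (n ∸ 1))

snowEdgesFrom : ℕ → List ℕ → List (SV × SV)
snowEdgesFrom i []       = []
snowEdgesFrom i (n ∷ ns) = Data.List._++_ (starEdges i n) (snowEdgesFrom (suc i) ns)

snowflake : List ℕ → Graph
snowflake ns = record { V = SV ; _≟V_ = _≟SV_ ; edges = snowEdgesFrom 0 ns }

IsSnowflakeData : List ℕ → Set
IsSnowflakeData ns = 1 ≤ length ns × All (3 ≤_) ns

IsEvenSnowflake : List ℕ → Set
IsEvenSnowflake ns =
  ∀ u → u ≢ center → 2 ≤ Graph.deg (snowflake ns) u → 2 ∣ Graph.deg (snowflake ns) u

-- A conservative labeling balances every hub, since hubs have degree at least 4, and the labels of a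
-- star sum to twice the flow into its hub; so 1 + 2 + ⋯ + M would be even, which fails for
-- M ≡ 2 (mod 4).  Conversely, the stars receive consecutive blocks of labels, and each block is split
-- into two halves of equal sum, the arcs into and out of the hub, by repeating the sign pattern + − − +
-- (or a variant skipping one label).  A block of size ≡ 2 (mod 4) has odd sum, so it swaps a boundary
-- label with its neighbour; the swap left over after the last star turns the label M into M + 1.
-- Reversing a whole star keeps it balanced, so the center edge of every star can carry any label of
-- its block in either direction; the label just below a block boundary and the second one above it
-- differ by 3, and two such boundaries traversed in opposite directions balance the center.
module Submission where

open import Defs
open import Data.Bool using (Bool; true; false; not; _xor_; if_then_else_; _∨_)
open import Data.Bool.Properties using (not-involutive; ¬-not)
import Data.Bool as Bool
open import Data.Nat using (ℕ; zero; suc; _+_; _*_; _∸_; _≤_; _<_; z≤n; s≤s; _%_)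
open import Data.Nat.Properties
open import Data.Nat.DivMod using (m*n%n≡0; [m+kn]%n≡m%n)
open import Data.Nat.Divisibility using (_∣_; divides; ∣m+n∣m⇒∣n)
open import Algebra.Properties.CommutativeSemigroup +-commutativeSemigroup using (x∙yz≈y∙xz; xy∙z≈y∙xz)
open import Data.Fin using (Fin; zero; suc; cast)
open import Data.Fin.Properties using (cast-is-id)
open import Data.List using (List; []; _∷_; _++_; [_]; length; map; zipWith; tabulate; lookup; allFin; concat; upTo; take; drop)
open import Data.List.Properties
  using (map-tabulate; tabulate-lookup; tabulate-cong; map-++; map-∘; map-id-local; ++-assoc; ++-identityʳ;
         length-map; length-upTo; length-tabulate; length-++; length-take; length-drop; take++drop≡id)
open import Data.Nat.ListAction using (sum)
open import Data.Nat.ListAction.Properties using (sum-++; sum-↭)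
open import Data.List.Membership.Propositional using (_∈_)
open import Data.List.Membership.Propositional.Properties using (∈-tabulate⁺; ∈-tabulate⁻; ∈-map⁻; ∈-∃++; ∈-++⁺ˡ)
open import Data.List.Membership.Propositional.Properties.WithK using (unique∧set⇒bag)
open import Data.List.Relation.Unary.All as All using (All; []; _∷_)
open import Data.List.Relation.Unary.Any using (here; there)
import Data.List.Relation.Unary.All.Properties as All
open import Data.List.Relation.Unary.Unique.Propositional using (Unique)
open import Data.List.Relation.Unary.AllPairs using ([]; _∷_)
open import Data.List.Relation.Unary.Unique.Propositional.Properties
  using () renaming (tabulate⁺ to unique-tabulate⁺; upTo⁺ to unique-upTo⁺)
open import Data.List.Relation.Binary.Permutation.Propositional
  using (_↭_; ↭-refl; ↭-sym; ↭-trans; ↭-prep; ↭-swap; ↭-reflexive; ↭⇒↭ₛ; module PermutationReasoning)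
open import Data.List.Relation.Binary.Permutation.Propositional.Properties
  using (∈-resp-↭; shift; ++⁺ˡ; ∷↭∷ʳ; ↭-length) renaming (map⁺ to ↭-map⁺; ++⁺ to ↭-++⁺)
import Data.List.Relation.Binary.Permutation.Setoid.Properties as PermutationₛProperties
open import Data.List.Relation.Binary.BagAndSetEquality using (∼bag⇒↭)
open import Data.Product using (_×_; _,_; proj₁; proj₂; ∃)
open import Data.Sum using (_⊎_; inj₁; inj₂)
open import Data.Empty using (⊥-elim)
open import Data.Integer as ℤ using (ℤ; _-_)
import Data.Integer.Properties as ℤ
open import Function using (_∘_; _⇔_; Equivalence)
open import Function.Bundles using (mk⇔)
open import Relation.Nullary using (¬_; Dec; does; yes; no)
open import Relation.Nullary.Decidable using (dec-true; dec-false)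
open import Relation.Binary.Definitions using (DecidableEquality)
open import Relation.Binary.PropositionalEquality hiding ([_])
open import Data.Nat.Tactic.RingSolver using (solve-∀)

zipWith-++ : ∀ {A B C : Set} (f : A → B → C) xs ys us vs → length xs ≡ length us →
  zipWith f (xs ++ ys) (us ++ vs) ≡ zipWith f xs us ++ zipWith f ys vs
zipWith-++ f []       ys []       vs refl = refl
zipWith-++ f (x ∷ xs) ys (u ∷ us) vs eq   = cong (f x u ∷_) (zipWith-++ f xs ys us vs (suc-injective eq))

sum-zipWith-const : ∀ {A B : Set} (f : A → B → ℕ) (g : B → ℕ) {xs ys} → All (λ x → ∀ y → f x y ≡ g y) xs →
  length xs ≡ length ys → sum (zipWith f xs ys) ≡ sum (map g ys)
sum-zipWith-const f g {ys = []}     []                 refl = refl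
sum-zipWith-const f g {ys = y ∷ ys} (fx≡gy ∷ fxs≡gys) eq   =
  cong₂ _+_ (fx≡gy y) (sum-zipWith-const f g fxs≡gys (suc-injective eq))

sum-map-const : ∀ {A : Set} (f : A → ℕ) c {xs} → All (λ x → f x ≡ c) xs → sum (map f xs) ≡ length xs * c
sum-map-const f c []             = refl
sum-map-const f c (fx≡c ∷ fxs≡c) = cong₂ _+_ fx≡c (sum-map-const f c fxs≡c)

sum-map-single : ∀ {xs : List ℕ} (f : ℕ → ℕ) b → Unique xs → (∀ t → t ≢ b → f t ≡ 0) → f b ≤ 1 →
  sum (map f xs) ≤ 1
sum-map-single f b []             f≡0 fb≤1 = z≤n
sum-map-single {x ∷ xs} f b (x∉xs ∷ unique) f≡0 fb≤1 with x ≟ b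
... | yes refl = subst (_≤ 1) (sym (trans (cong (f x +_) rest≡0) (+-identityʳ (f x)))) fb≤1
  where
  rest≡0 : sum (map f xs) ≡ 0
  rest≡0 = trans (sum-map-const f 0 (All.map (λ x≢t → f≡0 _ (x≢t ∘ sym)) x∉xs)) (*-zeroʳ (length xs))
... | no  x≢b  = subst (_≤ 1) (sym (cong (_+ sum (map f xs)) (f≡0 x x≢b))) (sum-map-single f b unique f≡0 fb≤1)

tabulate-lookup-zipWith : ∀ {A B C : Set} (g : A → B → C) xs (h : Fin (length xs) → B) →
  tabulate (λ i → g (lookup xs i) (h i)) ≡ zipWith g xs (tabulate h)
tabulate-lookup-zipWith g []       h = refl
tabulate-lookup-zipWith g (x ∷ xs) h = cong (g x (h zero) ∷_) (tabulate-lookup-zipWith g xs (h ∘ suc))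

tabulate-injective : ∀ {A : Set} {n} {f : Fin n → A} → Unique (tabulate f) →
  ∀ {i j} → f i ≡ f j → i ≡ j
tabulate-injective         (_ ∷ _)      {zero}  {zero}  _  = refl
tabulate-injective         (f₀∉ ∷ _)    {zero}  {suc j} eq = ⊥-elim (All.tabulate⁻ f₀∉ j eq)
tabulate-injective         (f₀∉ ∷ _)    {suc i} {zero}  eq = ⊥-elim (All.tabulate⁻ f₀∉ i (sym eq))
tabulate-injective {f = f} (_ ∷ unique) {suc i} {suc j} eq =
  cong suc (tabulate-injective {f = f ∘ suc} unique eq)

-- (o , l) carries the label l from the first listed endpoint of its edge to the second iff o.
Arc : Set
Arc = Bool × ℕ

reverseArc : Arc → Arc
reverseArc (o , l) = not o , l

reverseArc-involutive : ∀ a → reverseArc (reverseArc a) ≡ a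
reverseArc-involutive (o , l) = cong (_, l) (not-involutive o)

map-reverseArc-involutive : ∀ as → map reverseArc (map reverseArc as) ≡ as
map-reverseArc-involutive as = trans (sym (map-∘ as)) (map-id-local (All.universal reverseArc-involutive as))

map-proj₂-reverseArc : ∀ as → map proj₂ (map reverseArc as) ≡ map proj₂ as
map-proj₂-reverseArc as = sym (map-∘ as)

module _ {V : Set} (_≟_ : DecidableEquality V) where

  inflow : V → V × V → Arc → ℕ
  inflow u x (o , l) = if does (u ≟ (if o then proj₂ x else proj₁ x)) then l else 0

  incidence : V → V × V → ℕ
  incidence u x = if does (u ≟ proj₁ x) ∨ does (u ≟ proj₂ x) then 1 else 0

  Avoids : V → V × V → Set
  Avoids u x = u ≢ proj₁ x × u ≢ proj₂ x

  inflow-avoid : ∀ {u x} → Avoids u x → ∀ a → inflow u x a ≡ 0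
  inflow-avoid (u≢x₁ , u≢x₂) (true  , l) rewrite dec-false (_ ≟ _) u≢x₂ = refl
  inflow-avoid (u≢x₁ , u≢x₂) (false , l) rewrite dec-false (_ ≟ _) u≢x₁ = refl

  incidence-avoid : ∀ {u x} → Avoids u x → incidence u x ≡ 0
  incidence-avoid (u≢x₁ , u≢x₂) rewrite dec-false (_ ≟ _) u≢x₁ | dec-false (_ ≟ _) u≢x₂ = refl

  inflow-zero : ∀ {u xs} ys → All (Avoids u) xs → sum (zipWith (inflow u) xs ys) ≡ 0
  inflow-zero ys       []                  = refl
  inflow-zero []       (_ ∷ _)             = refl
  inflow-zero (y ∷ ys) (u∉x ∷ u∉xs) = cong₂ _+_ (inflow-avoid u∉x y) (inflow-zero ys u∉xs)

  incidence-zero : ∀ {u xs} → All (Avoids u) xs → sum (map (incidence u) xs) ≡ 0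
  incidence-zero []           = refl
  incidence-zero (u∉x ∷ u∉xs) = cong₂ _+_ (incidence-avoid u∉x) (incidence-zero u∉xs)

Enumerates : (ℕ → Set) → List ℕ → Set
Enumerates S T = Unique T × (∀ k → S k ⇔ k ∈ T)

module _ (G : Graph) where
  open Graph G

  arcsOf : Orientation → (Edge → ℕ) → List Arc
  arcsOf o lab = tabulate (λ e → o e , lab e)

  inflowAt : V → List Arc → ℕ
  inflowAt u as = sum (zipWith (inflow _≟V_ u) edges as)

  private
    sumℤ-+ : ∀ xs → sumℤ (map (λ n → ℤ.+ n) xs) ≡ ℤ.+ sum xs
    sumℤ-+ []       = refl
    sumℤ-+ (x ∷ xs) = cong (ℤ._+_ (ℤ.+ x)) (sumℤ-+ xs)

    sumℕ-sum : ∀ xs → sumℕ xs ≡ sum xs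
    sumℕ-sum []       = refl
    sumℕ-sum (x ∷ xs) = cong (x +_) (sumℕ-sum xs)

    ind-* : ∀ b l → ind b * l ≡ (if b then l else 0)
    ind-* true  l = +-identityʳ l
    ind-* false l = refl

    ind-if : ∀ b → ind b ≡ (if b then 1 else 0)
    ind-if true  = refl
    ind-if false = refl

    sum-allFin : ∀ (f : Edge → ℕ) → sumℤ (map (λ e → ℤ.+ f e) (allFin M)) ≡ ℤ.+ sum (tabulate f)
    sum-allFin f = trans (cong sumℤ (map-tabulate (λ e → e) (λ e → ℤ.+ f e)))
                   (trans (cong sumℤ (sym (map-tabulate f (λ n → ℤ.+ n)))) (sumℤ-+ (tabulate f)))

    inflow-head : ∀ (o : Orientation) (lab : Edge → ℕ) u e →
      ind (does (u ≟V headOf o e)) * lab e ≡ inflow _≟V_ u (ends e) (o e , lab e)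
    inflow-head o lab u e = ind-* (does (u ≟V headOf o e)) (lab e)

    inflow-tail : ∀ (o : Orientation) (lab : Edge → ℕ) u e →
      ind (does (u ≟V tailOf o e)) * lab e ≡ inflow _≟V_ u (ends e) (reverseArc (o e , lab e))
    inflow-tail o lab u e with o e
    ... | true  = ind-* (does (u ≟V proj₁ (ends e))) (lab e)
    ... | false = ind-* (does (u ≟V proj₂ (ends e))) (lab e)

  vertexSum-inflow : ∀ (o : Orientation) (lab : Edge → ℕ) u →
    vertexSum o lab u ≡ ℤ.+ inflowAt u (arcsOf o lab) - ℤ.+ inflowAt u (map reverseArc (arcsOf o lab))
  vertexSum-inflow o lab u = cong₂ _-_
    (trans (sum-allFin _) (cong (λ xs → ℤ.+ sum xs) (begin
      tabulate (λ e → ind (does (u ≟V headOf o e)) * lab e)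
        ≡⟨ tabulate-cong (inflow-head o lab u) ⟩
      tabulate (λ e → inflow _≟V_ u (lookup edges e) (o e , lab e))
        ≡⟨ tabulate-lookup-zipWith (inflow _≟V_ u) edges _ ⟩
      zipWith (inflow _≟V_ u) edges (arcsOf o lab) ∎)))
    (trans (sum-allFin _) (cong (λ xs → ℤ.+ sum xs) (begin
      tabulate (λ e → ind (does (u ≟V tailOf o e)) * lab e)
        ≡⟨ tabulate-cong (inflow-tail o lab u) ⟩
      tabulate (λ e → inflow _≟V_ u (lookup edges e) (reverseArc (o e , lab e)))
        ≡⟨ tabulate-lookup-zipWith (inflow _≟V_ u) edges _ ⟩
      zipWith (inflow _≟V_ u) edges (tabulate (reverseArc ∘ λ e → o e , lab e))
        ≡⟨ cong (zipWith (inflow _≟V_ u) edges) (sym (map-tabulate _ reverseArc)) ⟩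
      zipWith (inflow _≟V_ u) edges (map reverseArc (arcsOf o lab)) ∎)))
    where open ≡-Reasoning

  deg-incidence : ∀ u → deg u ≡ sum (map (incidence _≟V_ u) edges)
  deg-incidence u = begin
    sumℕ (map incident (allFin M))  ≡⟨ sumℕ-sum (map incident (allFin M)) ⟩
    sum (map incident (allFin M))   ≡⟨ cong sum (map-tabulate (λ e → e) incident) ⟩
    sum (tabulate incident)
      ≡⟨ cong sum (tabulate-cong (λ e → ind-if (does (u ≟V proj₁ (ends e)) ∨ does (u ≟V proj₂ (ends e))))) ⟩
    sum (tabulate (incidence _≟V_ u ∘ lookup edges))
      ≡⟨ cong sum (sym (map-tabulate (lookup edges) (incidence _≟V_ u))) ⟩
    sum (map (incidence _≟V_ u) (tabulate (lookup edges)))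
      ≡⟨ cong (sum ∘ map (incidence _≟V_ u)) (tabulate-lookup edges) ⟩
    sum (map (incidence _≟V_ u) edges) ∎
    where
    open ≡-Reasoning
    incident : Edge → ℕ
    incident e = ind (does (u ≟V proj₁ (ends e)) ∨ does (u ≟V proj₂ (ends e)))

  arcsOf-lookup : ∀ as (eq : M ≡ length as) →
    arcsOf (proj₁ ∘ lookup as ∘ cast eq) (proj₂ ∘ lookup as ∘ cast eq) ≡ as
  arcsOf-lookup as eq = trans (tabulate-cong (λ e → refl)) (tabulate-lookup-cast eq)
    where
    tabulate-lookup-cast : ∀ {n} (eq : n ≡ length as) → tabulate (lookup as ∘ cast eq) ≡ as
    tabulate-lookup-cast refl = trans (tabulate-cong (λ e → cong (lookup as) (cast-is-id refl e))) (tabulate-lookup as)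

  ↭⇒labelingOnto : ∀ {S T} {lab : Edge → ℕ} → Enumerates S T → tabulate lab ↭ T → IsLabelingOnto S lab
  ↭⇒labelingOnto {S} {T} {lab} (unique , S⇔∈T) labs↭T =
    tabulate-injective (Unique-resp-↭ (↭⇒↭ₛ (↭-sym labs↭T)) unique) ,
    (λ e → Equivalence.from (S⇔∈T (lab e)) (∈-resp-↭ labs↭T (∈-tabulate⁺ e))) ,
    (λ k Sk → let (e , k≡) = ∈-tabulate⁻ (∈-resp-↭ (↭-sym labs↭T) (Equivalence.to (S⇔∈T k) Sk))
              in e , sym k≡)
    where open PermutationₛProperties (setoid ℕ) using (Unique-resp-↭)

  labelingOnto⇒↭ : ∀ {S T} {lab : Edge → ℕ} → Enumerates S T → IsLabelingOnto S lab → tabulate lab ↭ T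
  labelingOnto⇒↭ {S} {T} {lab} (unique , S⇔∈T) (injective , labels∈S , onto) =
    ∼bag⇒↭ (unique∧set⇒bag (unique-tabulate⁺ injective) unique (mk⇔ to from))
    where
    to : ∀ {k} → k ∈ tabulate lab → k ∈ T
    to k∈ with e , refl ← ∈-tabulate⁻ k∈ = Equivalence.to (S⇔∈T (lab e)) (labels∈S e)
    from : ∀ {k} → k ∈ T → k ∈ tabulate lab
    from {k} k∈T with e , refl ← onto k (Equivalence.from (S⇔∈T k) k∈T) = ∈-tabulate⁺ e

range : ℕ → ℕ → List ℕ
range a zero    = []
range a (suc m) = a ∷ range (suc a) m

range-++ : ∀ a m k → range a (m + k) ≡ range a m ++ range (m + a) k
range-++ a zero    k = refl
range-++ a (suc m) k = cong (a ∷_) (trans (range-++ (suc a) m k) (cong (λ b → range (suc a) m ++ range b k) (+-suc m a)))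

range-∷ʳ : ∀ a m → range a (suc m) ≡ range a m ++ [ m + a ]
range-∷ʳ a m = trans (cong (range a) (+-comm 1 m)) (range-++ a m 1)

∈-range⁺ : ∀ {a m k} → a ≤ k → k < a + m → k ∈ range a m
∈-range⁺ {a} {zero}      a≤k k<a+0 = ⊥-elim (<-irrefl refl (<-≤-trans (subst (_ <_) (+-identityʳ a) k<a+0) a≤k))
∈-range⁺ {a} {suc m} {k} a≤k k<a+1+m with a ≟ k
... | yes refl = here refl
... | no  a≢k  = there (∈-range⁺ (≤∧≢⇒< a≤k a≢k) (subst (k <_) (+-suc a m) k<a+1+m))

∈-range⁻ : ∀ {a m k} → k ∈ range a m → a ≤ k × k < a + m
∈-range⁻ {a} {suc m}     (here refl) = ≤-refl , subst (a <_) (sym (+-suc a m)) (s≤s (m≤m+n a m))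
∈-range⁻ {a} {suc m} {k} (there k∈)  =
  let (a<k , k<a+1+m) = ∈-range⁻ k∈ in <⇒≤ a<k , subst (k <_) (sym (+-suc a m)) k<a+1+m

range-unique : ∀ a m → Unique (range a m)
range-unique a zero    = []
range-unique a (suc m) = All.tabulate (λ k∈ a≡k → <-irrefl a≡k (proj₁ (∈-range⁻ k∈))) ∷ range-unique (suc a) m

length-range : ∀ a m → length (range a m) ≡ m
length-range a zero    = refl
length-range a (suc m) = cong suc (length-range (suc a) m)

2*sum-range : ∀ m → 2 * sum (range 1 m) ≡ m * suc m
2*sum-range zero    = refl
2*sum-range (suc m) = begin
  2 * sum (range 1 (suc m))         ≡⟨ cong (λ xs → 2 * sum xs) (range-∷ʳ 1 m) ⟩
  2 * sum (range 1 m ++ [ m + 1 ])  ≡⟨ cong (2 *_) (sum-++ (range 1 m) [ m + 1 ]) ⟩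
  2 * (sum (range 1 m) + (m + 1 + 0)) ≡⟨ *-distribˡ-+ 2 (sum (range 1 m)) _ ⟩
  2 * sum (range 1 m) + 2 * (m + 1 + 0) ≡⟨ cong (_+ 2 * (m + 1 + 0)) (2*sum-range m) ⟩
  m * suc m + 2 * (m + 1 + 0)       ≡⟨ arithmetic m ⟩
  suc m * suc (suc m) ∎
  where
  open ≡-Reasoning
  arithmetic : ∀ m → m * suc m + 2 * (m + 1 + 0) ≡ suc m * suc (suc m)
  arithmetic = solve-∀

sum-range-odd : ∀ t X → sum (range 1 (t * 4 + 2)) ≢ 2 * X
sum-range-odd t X sum≡2X = even≢odd X (4 * t * t + 5 * t + 1) (*-cancelˡ-≡ (2 * X) _ 2 (begin
  2 * (2 * X)                               ≡⟨ cong (2 *_) sum≡2X ⟨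
  2 * sum (range 1 (t * 4 + 2))             ≡⟨ 2*sum-range (t * 4 + 2) ⟩
  (t * 4 + 2) * suc (t * 4 + 2)             ≡⟨ arithmetic t ⟩
  2 * suc (2 * (4 * t * t + 5 * t + 1))     ∎))
  where
  open ≡-Reasoning
  arithmetic : ∀ t → (t * 4 + 2) * suc (t * 4 + 2) ≡ 2 * suc (2 * (4 * t * t + 5 * t + 1))
  arithmetic = solve-∀

consLabels-enumeration : ∀ m → Enumerates (λ k → 1 ≤ k × k ≤ m) (range 1 m)
consLabels-enumeration m = range-unique 1 m , λ k →
  mk⇔ (λ (1≤k , k≤m) → ∈-range⁺ 1≤k (s≤s k≤m))
      (λ k∈ → let (1≤k , k<1+m) = ∈-range⁻ k∈ in 1≤k , m<1+n⇒m≤n k<1+m)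

nearLabels-enumeration : ∀ m → Enumerates (λ k → (1 ≤ k × k ≤ m ∸ 1) ⊎ k ≡ suc m) (suc m ∷ range 1 (m ∸ 1))
nearLabels-enumeration m =
  All.tabulate (λ k∈ 1+m≡k → <-irrefl (sym 1+m≡k) (<-≤-trans (proj₂ (∈-range⁻ k∈)) (s≤s (m∸n≤m m 1))))
    ∷ range-unique 1 (m ∸ 1) ,
  λ k → mk⇔ (λ { (inj₁ (1≤k , k≤m-1)) → there (∈-range⁺ 1≤k (s≤s k≤m-1)) ; (inj₂ refl) → here refl })
            (λ { (here refl) → inj₂ refl
               ; (there k∈) → let (1≤k , k<m) = ∈-range⁻ k∈ in inj₁ (1≤k , m<1+n⇒m≤n k<m) })

inward : Arc → ℕ
inward (true  , l) = l
inward (false , _) = 0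

inwardSum : List Arc → ℕ
inwardSum as = sum (map inward as)

record Balanced (as : List Arc) : Set where
  constructor balanced
  field balance : inwardSum as ≡ inwardSum (map reverseArc as)
open Balanced

inwardSum-++ : ∀ xs ys → inwardSum (xs ++ ys) ≡ inwardSum xs + inwardSum ys
inwardSum-++ xs ys = trans (cong sum (map-++ inward xs ys)) (sum-++ (map inward xs) (map inward ys))

inwardSum-↭ : ∀ {xs ys} → xs ↭ ys → inwardSum xs ≡ inwardSum ys
inwardSum-↭ xs↭ys = sum-↭ (↭-map⁺ inward xs↭ys)

Balanced-++ : ∀ {xs ys} → Balanced xs → Balanced ys → Balanced (xs ++ ys)
Balanced-++ {xs} {ys} (balanced xs-bal) (balanced ys-bal) = balanced (begin
  inwardSum (xs ++ ys)                                      ≡⟨ inwardSum-++ xs ys ⟩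
  inwardSum xs + inwardSum ys                               ≡⟨ cong₂ _+_ xs-bal ys-bal ⟩
  inwardSum (map reverseArc xs) + inwardSum (map reverseArc ys) ≡⟨ inwardSum-++ (map reverseArc xs) _ ⟨
  inwardSum (map reverseArc xs ++ map reverseArc ys)        ≡⟨ cong inwardSum (map-++ reverseArc xs ys) ⟨
  inwardSum (map reverseArc (xs ++ ys))                     ∎)
  where open ≡-Reasoning

Balanced-↭ : ∀ {xs ys} → xs ↭ ys → Balanced xs → Balanced ys
Balanced-↭ xs↭ys (balanced xs-bal) =
  balanced (trans (inwardSum-↭ (↭-sym xs↭ys)) (trans xs-bal (inwardSum-↭ (↭-map⁺ reverseArc xs↭ys))))

Balanced-reverse : ∀ {as} → Balanced as → Balanced (map reverseArc as)
Balanced-reverse {as} (balanced as-bal) =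
  balanced (trans (sym as-bal) (cong inwardSum (sym (map-reverseArc-involutive as))))

sum-labels-split : ∀ as → sum (map proj₂ as) ≡ inwardSum as + inwardSum (map reverseArc as)
sum-labels-split []                 = refl
sum-labels-split ((true  , l) ∷ as) = trans (cong (l +_) (sum-labels-split as)) (sym (+-assoc l _ _))
sum-labels-split ((false , l) ∷ as) =
  trans (cong (l +_) (sum-labels-split as)) (x∙yz≈y∙xz l (inwardSum as) (inwardSum (map reverseArc as)))

withHead : ∀ {L h} σ → Balanced L → h ∈ map proj₂ L →
  ∃ λ t → Balanced ((σ , h) ∷ t) × (h ∷ map proj₂ t) ↭ map proj₂ L
withHead σ L-bal h∈ with ∈-map⁻ proj₂ h∈
... | (o , h) , x∈L , refl with ∈-∃++ x∈L
... | xs , ys , refl with o Bool.≟ σ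
... | yes refl = xs ++ ys , Balanced-↭ (shift _ xs ys) L-bal , ↭-sym (↭-map⁺ proj₂ (shift _ xs ys))
... | no  o≢σ rewrite ¬-not (o≢σ ∘ sym) =
  map reverseArc (xs ++ ys) ,
  Balanced-reverse (Balanced-↭ (shift (o , h) xs ys) L-bal) ,
  subst (λ ls → h ∷ ls ↭ map proj₂ (xs ++ [ o , h ] ++ ys)) (sym (map-proj₂-reverseArc (xs ++ ys)))
    (↭-sym (↭-map⁺ proj₂ (shift (o , h) xs ys)))

-- A balanced star on a block of labels

Shape : Set
Shape = Bool × ℕ

extra : Shape → ℕ
extra (false , q) = q * 4
extra (true  , q) = 2 + q * 4

size : Shape → ℕ
size s = 4 + extra s

shiftArc : ℕ → Arc → Arc
shiftArc b (σ , v) = σ , v + b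

-- quad′ and hexBot skip the offset 1 and hexTop the offset 6: the labels swapped with the neighbouring blocks.
quad quad′ hexTop hexBot : List Arc
quad   = (true , 1) ∷ (false , 2) ∷ (false , 3) ∷ (true , 4) ∷ []
quad′  = (true , 0) ∷ (false , 2) ∷ (false , 3) ∷ (true , 5) ∷ []
hexTop = (true , 1) ∷ (false , 2) ∷ (true , 3) ∷ (false , 4) ∷ (false , 5) ∷ (true , 7) ∷ []
hexBot = (true , 0) ∷ (false , 2) ∷ (false , 3) ∷ (true , 4) ∷ (false , 5) ∷ (true , 6) ∷ []

inwardCount : List Arc → ℕ
inwardCount as = inwardSum (map (λ (σ , _) → σ , 1) as)

inwardSum-shift : ∀ b as → inwardSum (map (shiftArc b) as) ≡ inwardSum as + inwardCount as * b
inwardSum-shift b []               = refl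
inwardSum-shift b ((true  , v) ∷ as) =
  trans (cong (v + b +_) (inwardSum-shift b as)) (arithmetic v b (inwardSum as) (inwardCount as))
  where
  arithmetic : ∀ v b s c → v + b + (s + c * b) ≡ v + s + (1 + c) * b
  arithmetic = solve-∀
inwardSum-shift b ((false , v) ∷ as) = inwardSum-shift b as

shift-balanced : ∀ b {as} → Balanced as → inwardCount as ≡ inwardCount (map reverseArc as) →
  Balanced (map (shiftArc b) as)
shift-balanced b {as} (balanced as-bal) counts = balanced (begin
  inwardSum (map (shiftArc b) as)                      ≡⟨ inwardSum-shift b as ⟩
  inwardSum as + inwardCount as * b                     ≡⟨ cong₂ (λ s c → s + c * b) as-bal counts ⟩
  inwardSum (map reverseArc as) + inwardCount (map reverseArc as) * b
    ≡⟨ inwardSum-shift b (map reverseArc as) ⟨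
  inwardSum (map (shiftArc b) (map reverseArc as))     ≡⟨ cong inwardSum (sym (map-∘ as)) ⟩
  inwardSum (map (shiftArc b ∘ reverseArc) as)         ≡⟨ cong inwardSum (map-∘ as) ⟩
  inwardSum (map reverseArc (map (shiftArc b) as))     ∎)
  where open ≡-Reasoning

repeatBlock : List Arc → ℕ → ℕ → List Arc
repeatBlock B b zero    = []
repeatBlock B b (suc k) = map (shiftArc b) B ++ repeatBlock B (4 + b) k

repeatBlock-balanced : ∀ B → Balanced B → inwardCount B ≡ inwardCount (map reverseArc B) →
  ∀ b k → Balanced (repeatBlock B b k)
repeatBlock-balanced B B-bal counts b zero    = balanced refl
repeatBlock-balanced B B-bal counts b (suc k) =
  Balanced-++ (shift-balanced b B-bal counts) (repeatBlock-balanced B B-bal counts (4 + b) k)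

starPattern : Bool → Shape → ℕ → List Arc
starPattern false (false , q) b = repeatBlock quad b (suc q)
starPattern true  (false , q) b = repeatBlock quad′ b (suc q)
starPattern false (true  , q) b = repeatBlock quad b q ++ map (shiftArc (q * 4 + b)) hexTop
starPattern true  (true  , q) b = map (shiftArc b) hexBot ++ repeatBlock quad (6 + b) q

starPattern-balanced : ∀ c s b → Balanced (starPattern c s b)
starPattern-balanced false (false , q) b = repeatBlock-balanced quad (balanced refl) refl b (suc q)
starPattern-balanced true  (false , q) b = repeatBlock-balanced quad′ (balanced refl) refl b (suc q)
starPattern-balanced false (true  , q) b =
  Balanced-++ (repeatBlock-balanced quad (balanced refl) refl b q) (shift-balanced (q * 4 + b) {hexTop} (balanced refl) refl)
starPattern-balanced true  (true  , q) b =
  Balanced-++ (shift-balanced b {hexBot} (balanced refl) refl) (repeatBlock-balanced quad (balanced refl) refl (6 + b) q)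

-- The block b + 1, …, b + n, with its first label swapped with the previous block if c and its last
-- label swapped with the next block if c′.
starValues : Bool → Bool → ℕ → ℕ → List ℕ
starValues c c′ b n = (if c then b else suc b) ∷ range (2 + b) (n ∸ 2) ++ [ if c′ then suc (n + b) else n + b ]

length-starValues : ∀ c c′ b g → length (starValues c c′ b (2 + g)) ≡ 2 + g
length-starValues c c′ b g =
  cong suc (trans (length-++ (range (2 + b) g)) (trans (cong (_+ 1) (length-range (2 + b) g)) (+-comm g 1)))

repeatQuad-values : ∀ b k → map proj₂ (repeatBlock quad b k) ≡ range (suc b) (k * 4)
repeatQuad-values b zero    = refl
repeatQuad-values b (suc k) = cong (λ vs → 1 + b ∷ 2 + b ∷ 3 + b ∷ 4 + b ∷ vs) (repeatQuad-values (4 + b) k)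

repeatQuad′-values : ∀ b q →
  map proj₂ (repeatBlock quad′ b (suc q)) ↭ b ∷ range (2 + b) (2 + q * 4) ++ [ suc (4 + q * 4 + b) ]
repeatQuad′-values b zero    = ↭-refl
repeatQuad′-values b (suc q) =
  ↭-prep b (↭-prep (2 + b) (↭-prep (3 + b) (↭-trans (↭-prep (5 + b) (repeatQuad′-values (4 + b) q))
    (↭-swap (5 + b) (4 + b) (↭-reflexive (cong (λ v → range (6 + b) (2 + q * 4) ++ [ suc v ]) (arithmetic q b)))))))
  where
  arithmetic : ∀ q b → 4 + q * 4 + (4 + b) ≡ 4 + (4 + q * 4) + b
  arithmetic = solve-∀

quads-values : ∀ q b → map proj₂ (starPattern false (false , q) b) ≡ starValues false false b (size (false , q))
quads-values q b = begin
  map proj₂ (repeatBlock quad b (suc q))                       ≡⟨ repeatQuad-values b (suc q) ⟩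
  suc b ∷ range (2 + b) (3 + q * 4)                            ≡⟨ cong (suc b ∷_) (range-∷ʳ (2 + b) (2 + q * 4)) ⟩
  suc b ∷ range (2 + b) (2 + q * 4) ++ [ 2 + q * 4 + (2 + b) ]
    ≡⟨ cong (λ v → suc b ∷ range (2 + b) (2 + q * 4) ++ [ v ]) (arithmetic q b) ⟩
  suc b ∷ range (2 + b) (2 + q * 4) ++ [ 4 + q * 4 + b ]       ∎
  where
  open ≡-Reasoning
  arithmetic : ∀ q b → 2 + q * 4 + (2 + b) ≡ 4 + q * 4 + b
  arithmetic = solve-∀

quads-hexTop-values : ∀ q b → map proj₂ (starPattern false (true , q) b) ≡ starValues false true b (size (true , q))
quads-hexTop-values q b = begin
  map proj₂ (repeatBlock quad b q ++ map (shiftArc t) hexTop)        ≡⟨ map-++ proj₂ (repeatBlock quad b q) _ ⟩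
  map proj₂ (repeatBlock quad b q) ++ range (suc t) 5 ++ [ 7 + t ]
    ≡⟨ cong (_++ range (suc t) 5 ++ [ 7 + t ]) (repeatQuad-values b q) ⟩
  range (suc b) (q * 4) ++ range (suc t) 5 ++ [ 7 + t ]              ≡⟨ ++-assoc (range (suc b) (q * 4)) _ _ ⟨
  (range (suc b) (q * 4) ++ range (suc t) 5) ++ [ 7 + t ]
    ≡⟨ cong (λ a → (range (suc b) (q * 4) ++ range a 5) ++ [ 7 + t ]) (+-suc (q * 4) b) ⟨
  (range (suc b) (q * 4) ++ range (q * 4 + suc b) 5) ++ [ 7 + t ]    ≡⟨ cong (_++ [ 7 + t ]) (range-++ (suc b) (q * 4) 5) ⟨
  range (suc b) (q * 4 + 5) ++ [ 7 + t ]
    ≡⟨ cong (λ m → range (suc b) m ++ [ 7 + t ]) (+-comm (q * 4) 5) ⟩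
  suc b ∷ range (2 + b) (4 + q * 4) ++ [ 7 + t ]                     ∎
  where
  open ≡-Reasoning
  t = q * 4 + b

hexBot-quads-values : ∀ q b → map proj₂ (starPattern true (true , q) b) ≡ starValues true false b (size (true , q))
hexBot-quads-values q b = begin
  b ∷ 2 + b ∷ 3 + b ∷ 4 + b ∷ 5 + b ∷ 6 + b ∷ map proj₂ (repeatBlock quad (6 + b) q)
    ≡⟨ cong (λ vs → b ∷ 2 + b ∷ 3 + b ∷ 4 + b ∷ 5 + b ∷ 6 + b ∷ vs) (repeatQuad-values (6 + b) q) ⟩
  b ∷ range (2 + b) (5 + q * 4)                                ≡⟨ cong (b ∷_) (range-∷ʳ (2 + b) (4 + q * 4)) ⟩
  b ∷ range (2 + b) (4 + q * 4) ++ [ 4 + q * 4 + (2 + b) ]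
    ≡⟨ cong (λ v → b ∷ range (2 + b) (4 + q * 4) ++ [ v ]) (arithmetic q b) ⟩
  b ∷ range (2 + b) (4 + q * 4) ++ [ 6 + q * 4 + b ]           ∎
  where
  open ≡-Reasoning
  arithmetic : ∀ q b → 4 + q * 4 + (2 + b) ≡ 6 + q * 4 + b
  arithmetic = solve-∀

starPattern-values : ∀ c s b → map proj₂ (starPattern c s b) ↭ starValues c (c xor proj₁ s) b (size s)
starPattern-values false (false , q) b = ↭-reflexive (quads-values q b)
starPattern-values true  (false , q) b = repeatQuad′-values b q
starPattern-values false (true  , q) b = ↭-reflexive (quads-hexTop-values q b)
starPattern-values true  (true  , q) b = ↭-reflexive (hexBot-quads-values q b)

star : ∀ c s b σ {h} → h ∈ starValues c (c xor proj₁ s) b (size s) →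
  ∃ λ t → Balanced ((σ , h) ∷ t) × (h ∷ map proj₂ t) ↭ starValues c (c xor proj₁ s) b (size s)
star c s b σ h∈ =
  let (t , balanced-star , values) = withHead σ (starPattern-balanced c s b)
                                              (∈-resp-↭ (↭-sym (starPattern-values c s b)) h∈)
  in t , balanced-star , ↭-trans values (starPattern-values c s b)

-- Carries between consecutive blocks

carry : Bool → List Shape → Bool
carry c []       = c
carry c (s ∷ ss) = carry (c xor proj₁ s) ss

totalSize : List Shape → ℕ
totalSize ss = sum (map size ss)

chainValues : Bool → ℕ → List Shape → List ℕ
chainValues c b []       = []
chainValues c b (s ∷ ss) = starValues c (c xor proj₁ s) b (size s) ++ chainValues (c xor proj₁ s) (size s + b) ss

starValues-++ : ∀ c c′ c″ b g g′ →
  starValues c c′ b (2 + g) ++ starValues c′ c″ (2 + g + b) (2 + g′) ↭ starValues c c″ b (2 + g + (2 + g′))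
starValues-++ c c′ c″ b g g′ = begin
  (β ∷ range (2 + b) g ++ [ τ ]) ++ τ′ ∷ rest
    ≡⟨ cong (β ∷_) (++-assoc (range (2 + b) g) [ τ ] (τ′ ∷ rest)) ⟩
  β ∷ range (2 + b) g ++ τ ∷ τ′ ∷ rest
    ↭⟨ ↭-prep β (++⁺ˡ (range (2 + b) g) (boundary c′)) ⟩
  β ∷ range (2 + b) g ++ range (2 + g + b) (2 + g′) ++ [ end (2 + g′ + (2 + g + b)) ]
    ≡⟨ cong (β ∷_) (++-assoc (range (2 + b) g) _ _) ⟨
  β ∷ (range (2 + b) g ++ range (2 + g + b) (2 + g′)) ++ [ end (2 + g′ + (2 + g + b)) ]
    ≡⟨ cong₂ (λ a n → β ∷ (range (2 + b) g ++ range a (2 + g′)) ++ [ end n ]) (offset g b) (arithmetic g g′ b) ⟨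
  β ∷ (range (2 + b) g ++ range (g + (2 + b)) (2 + g′)) ++ [ end (2 + g + (2 + g′) + b) ]
    ≡⟨ cong (λ vs → β ∷ vs ++ [ end (2 + g + (2 + g′) + b) ]) (range-++ (2 + b) g (2 + g′)) ⟨
  β ∷ range (2 + b) (g + (2 + g′)) ++ [ end (2 + g + (2 + g′) + b) ] ∎
  where
  open PermutationReasoning
  β = if c then b else suc b
  τ = if c′ then suc (2 + g + b) else 2 + g + b
  τ′ = if c′ then 2 + g + b else suc (2 + g + b)
  end : ℕ → ℕ
  end n = if c″ then suc n else n
  rest = range (2 + (2 + g + b)) g′ ++ [ end (2 + g′ + (2 + g + b)) ]
  boundary : ∀ c′ → (if c′ then suc (2 + g + b) else 2 + g + b) ∷ (if c′ then 2 + g + b else suc (2 + g + b)) ∷ rest ↭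
                    2 + g + b ∷ suc (2 + g + b) ∷ rest
  boundary true  = ↭-swap _ _ ↭-refl
  boundary false = ↭-refl
  offset : ∀ g b → g + (2 + b) ≡ 2 + g + b
  offset = solve-∀
  arithmetic : ∀ g g′ b → 2 + g + (2 + g′) + b ≡ 2 + g′ + (2 + g + b)
  arithmetic = solve-∀

chainValues-↭ : ∀ c b s ss → chainValues c b (s ∷ ss) ↭ starValues c (carry c (s ∷ ss)) b (totalSize (s ∷ ss))
chainValues-↭ c b s [] = ↭-reflexive (trans (++-identityʳ _) (cong (starValues c (c xor proj₁ s) b) (sym (+-identityʳ (size s)))))
chainValues-↭ c b s (s′ ∷ ss) =
  ↭-trans (++⁺ˡ (starValues c (c xor proj₁ s) b (size s)) (chainValues-↭ (c xor proj₁ s) (size s + b) s′ ss))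
          (starValues-++ c (c xor proj₁ s) (carry c (s ∷ s′ ∷ ss)) b (2 + extra s) (2 + extra s′ + totalSize ss))

initialValues-conservative : ∀ g → starValues false false 0 (2 + g) ≡ range 1 (2 + g)
initialValues-conservative g = sym (trans (cong (1 ∷_) (range-∷ʳ 2 g)) (cong (λ n → 1 ∷ range 2 g ++ [ n ]) (arithmetic g)))
  where
  arithmetic : ∀ g → g + 2 ≡ 2 + g + 0
  arithmetic = solve-∀

initialValues-near : ∀ g → starValues false true 0 (2 + g) ↭ suc (2 + g) ∷ range 1 (suc g)
initialValues-near g =
  ↭-trans (↭-sym (∷↭∷ʳ (suc (2 + g + 0)) (1 ∷ range 2 g)))
          (↭-reflexive (cong (λ n → suc n ∷ 1 ∷ range 2 g) (+-identityʳ (2 + g))))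

twice : Bool → ℕ
twice c = if c then 2 else 0

star-mod4 : ∀ c s → ∃ λ k → size s + twice c ≡ k * 4 + twice (c xor proj₁ s)
star-mod4 false (false , q) = suc q , refl
star-mod4 true  (false , q) = suc q , refl
star-mod4 false (true  , q) = suc q , arithmetic q
  where
  arithmetic : ∀ q → 4 + (2 + q * 4) + 0 ≡ suc q * 4 + 2
  arithmetic = solve-∀
star-mod4 true  (true  , q) = 2 + q , arithmetic q
  where
  arithmetic : ∀ q → 4 + (2 + q * 4) + 2 ≡ (2 + q) * 4 + 0
  arithmetic = solve-∀

totalSize-mod4 : ∀ c ss → ∃ λ t → totalSize ss + twice c ≡ t * 4 + twice (carry c ss)
totalSize-mod4 c []       = 0 , refl
totalSize-mod4 c (s ∷ ss) =
  let (k , star≡) = star-mod4 c s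
      (t , rest≡) = totalSize-mod4 (c xor proj₁ s) ss
  in k + t , (begin
    size s + totalSize ss + twice c             ≡⟨ xy∙z≈y∙xz (size s) (totalSize ss) (twice c) ⟩
    totalSize ss + (size s + twice c)           ≡⟨ cong (totalSize ss +_) star≡ ⟩
    totalSize ss + (k * 4 + twice (c xor proj₁ s)) ≡⟨ x∙yz≈y∙xz (totalSize ss) (k * 4) _ ⟩
    k * 4 + (totalSize ss + twice (c xor proj₁ s)) ≡⟨ cong (k * 4 +_) rest≡ ⟩
    k * 4 + (t * 4 + twice (carry c (s ∷ ss)))  ≡⟨ arithmetic k t _ ⟩
    (k + t) * 4 + twice (carry c (s ∷ ss))      ∎)
  where
  open ≡-Reasoning
  arithmetic : ∀ k t c → k * 4 + (t * 4 + c) ≡ (k + t) * 4 + c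
  arithmetic = solve-∀

shape-of : ∀ {n} → 3 ≤ n → 2 ∣ n → ∃ λ s → size s ≡ n
shape-of {0} () _
shape-of {1} (s≤s ()) _
shape-of {2} (s≤s (s≤s ())) _
shape-of {3} _ (divides zero ())
shape-of {3} _ (divides (suc zero) ())
shape-of {3} _ (divides (suc (suc _)) ())
shape-of {4} _ _ = (false , 0) , refl
shape-of {5} _ (divides zero ())
shape-of {5} _ (divides (suc zero) ())
shape-of {5} _ (divides (suc (suc zero)) ())
shape-of {5} _ (divides (suc (suc (suc _))) ())
shape-of {6} _ _ = (true , 0) , refl
shape-of {suc (suc (suc (suc (suc (suc (suc n))))))} _ 2∣n =
  let ((w , q) , size≡) = shape-of {suc (suc (suc n))} (s≤s (s≤s (s≤s z≤n))) (∣m+n∣m⇒∣n 2∣n (divides 2 refl))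
  in (w , suc q) , cong (4 +_) (bump w q size≡)
  where
  bump : ∀ w q → size (w , q) ≡ 3 + n → extra (w , suc q) ≡ 3 + n
  bump false q eq = eq
  bump true  q eq = eq

shapes-of : ∀ {ns} → All (3 ≤_) ns → All (2 ∣_) ns → ∃ λ ss → map size ss ≡ ns
shapes-of []            []            = [] , refl
shapes-of (3≤n ∷ 3≤ns) (2∣n ∷ 2∣ns) =
  let (s , size≡)   = shape-of 3≤n 2∣n
      (ss , sizes≡) = shapes-of 3≤ns 2∣ns
  in s ∷ ss , cong₂ _∷_ size≡ sizes≡

-- A star is described by its hub view, whose bits say whether the arcs point to the hub, center edge
-- first; only the leaf edges list the hub first.
starArcs : List Arc → List Arc
starArcs []      = []
starArcs (h ∷ t) = h ∷ map reverseArc t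

snowArcs : List (List Arc) → List Arc
snowArcs Hs = concat (map starArcs Hs)

data Chunks : List ℕ → List (List Arc) → Set where
  []  : Chunks [] []
  _∷_ : ∀ {n ns h t Hs} → length t ≡ n ∸ 1 → Chunks ns Hs → Chunks (n ∷ ns) ((h ∷ t) ∷ Hs)

heads : List (List Arc) → List Arc
heads []             = []
heads ([] ∷ Hs)      = heads Hs
heads ((h ∷ _) ∷ Hs) = h ∷ heads Hs

inflowFrom : SV → ℕ → List ℕ → List Arc → ℕ
inflowFrom u i ns as = sum (zipWith (inflow _≟SV_ u) (snowEdgesFrom i ns) as)

starInflow : SV → ℕ → ℕ → List Arc → ℕ
starInflow u i n as = sum (zipWith (inflow _≟SV_ u) (starEdges i n) as)

does-refl : ∀ v → does (v ≟SV v) ≡ true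
does-refl v = dec-true (v ≟SV v) refl

length-starEdges : ∀ i n → length (starEdges i n) ≡ suc (n ∸ 1)
length-starEdges i n = cong suc (trans (length-map _ (upTo (n ∸ 1))) (length-upTo (n ∸ 1)))

leafEdges : ∀ i n → ∀ {P : SV × SV → Set} → (∀ t → P (hub i , leaf i t)) → All P (map (λ t → hub i , leaf i t) (upTo n))
leafEdges i n Pleaf = All.map⁺ (All.universal Pleaf (upTo n))

OutsideStar : SV → ℕ → Set
OutsideStar u i = u ≢ center × u ≢ hub i × (∀ t → u ≢ leaf i t)

hub-outside : ∀ {i j} → j ≢ i → OutsideStar (hub j) i
hub-outside j≢i = (λ ()) , j≢i ∘ hub-inj , (λ t ())

leaf-outside : ∀ {i a b} → a ≢ i → OutsideStar (leaf a b) i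
leaf-outside a≢i = (λ ()) , (λ ()) , (λ t → a≢i ∘ leaf-inj₁)

starEdges-avoid : ∀ {u i} n → OutsideStar u i → All (Avoids _≟SV_ u) (starEdges i n)
starEdges-avoid {i = i} n (u≢center , u≢hub , u≢leaf) =
  (u≢center , u≢hub) ∷ leafEdges i (n ∸ 1) (λ t → u≢hub , u≢leaf t)

snowEdges-avoid : ∀ {u i} ns → (∀ {s} → i ≤ s → OutsideStar u s) → All (Avoids _≟SV_ u) (snowEdgesFrom i ns)
snowEdges-avoid []       outside = []
snowEdges-avoid (n ∷ ns) outside = All.++⁺ (starEdges-avoid n (outside ≤-refl)) (snowEdges-avoid ns (outside ∘ <⇒≤))

starInflow-ownHub : ∀ i n h {t} → length t ≡ n ∸ 1 → starInflow (hub i) i n (starArcs (h ∷ t)) ≡ inwardSum (h ∷ t)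
starInflow-ownHub i n h {t} len = cong₂ _+_ (center-edge h) (begin
  sum (zipWith (inflow _≟SV_ (hub i)) (map (λ t → hub i , leaf i t) (upTo (n ∸ 1))) (map reverseArc t))
    ≡⟨ sum-zipWith-const _ (inward ∘ reverseArc) (leafEdges i (n ∸ 1) leaf-edge)
         (trans (length-map _ (upTo (n ∸ 1))) (trans (length-upTo (n ∸ 1)) (trans (sym len) (sym (length-map reverseArc t))))) ⟩
  sum (map (inward ∘ reverseArc) (map reverseArc t)) ≡⟨ cong sum (map-∘ (map reverseArc t)) ⟩
  inwardSum (map reverseArc (map reverseArc t))      ≡⟨ cong inwardSum (map-reverseArc-involutive t) ⟩
  inwardSum t ∎)
  where
  open ≡-Reasoning
  center-edge : ∀ a → inflow _≟SV_ (hub i) (center , hub i) a ≡ inward a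
  center-edge (true  , l) rewrite does-refl (hub i) = refl
  center-edge (false , l) = refl
  leaf-edge : ∀ t a → inflow _≟SV_ (hub i) (hub i , leaf i t) a ≡ inward (reverseArc a)
  leaf-edge t (true  , l) = refl
  leaf-edge t (false , l) rewrite does-refl (hub i) = refl

starInflow-center : ∀ i n h t → starInflow center i n (starArcs (h ∷ t)) ≡ inward (reverseArc h)
starInflow-center i n h t =
  trans (cong₂ _+_ (center-edge h) (inflow-zero _≟SV_ {center} (map reverseArc t) (leafEdges i (n ∸ 1) (λ t → (λ ()) , (λ ())))))
        (+-identityʳ _)
  where
  center-edge : ∀ a → inflow _≟SV_ center (center , hub i) a ≡ inward (reverseArc a)
  center-edge (true  , l) = refl
  center-edge (false , l) = refl

inflowFrom-∷ : ∀ u i n ns h {t} as → length t ≡ n ∸ 1 →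
  inflowFrom u i (n ∷ ns) (starArcs (h ∷ t) ++ as) ≡ starInflow u i n (starArcs (h ∷ t)) + inflowFrom u (suc i) ns as
inflowFrom-∷ u i n ns h {t} as len =
  trans (cong sum (zipWith-++ (inflow _≟SV_ u) (starEdges i n) (snowEdgesFrom (suc i) ns) (starArcs (h ∷ t)) as
                   (trans (length-starEdges i n) (cong suc (trans (sym len) (sym (length-map reverseArc t)))))))
        (sum-++ (zipWith (inflow _≟SV_ u) (starEdges i n) (starArcs (h ∷ t))) _)

snowArcs-reverse : ∀ Hs → map reverseArc (snowArcs Hs) ≡ snowArcs (map (map reverseArc) Hs)
snowArcs-reverse []             = refl
snowArcs-reverse ([] ∷ Hs)      = snowArcs-reverse Hs
snowArcs-reverse ((h ∷ t) ∷ Hs) =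
  trans (map-++ reverseArc (starArcs (h ∷ t)) (snowArcs Hs)) (cong (starArcs (map reverseArc (h ∷ t)) ++_) (snowArcs-reverse Hs))

Chunks-reverse : ∀ {ns Hs} → Chunks ns Hs → Chunks ns (map (map reverseArc) Hs)
Chunks-reverse []                       = []
Chunks-reverse (_∷_ {t = t} len chunks) = trans (length-map reverseArc t) len ∷ Chunks-reverse chunks

inflowFrom-ownHub : ∀ i n ns h {t} as → length t ≡ n ∸ 1 →
  inflowFrom (hub i) i (n ∷ ns) (starArcs (h ∷ t) ++ as) ≡ inwardSum (h ∷ t)
inflowFrom-ownHub i n ns h as len =
  trans (inflowFrom-∷ (hub i) i n ns h as len)
        (trans (cong₂ _+_ (starInflow-ownHub i n h len) (inflow-zero _≟SV_ as (snowEdges-avoid ns (hub-outside ∘ <⇒≢))))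
               (+-identityʳ _))

inflowFrom-otherHub : ∀ {i j} n ns h {t} as → j ≢ i → length t ≡ n ∸ 1 →
  inflowFrom (hub j) i (n ∷ ns) (starArcs (h ∷ t) ++ as) ≡ inflowFrom (hub j) (suc i) ns as
inflowFrom-otherHub {i} {j} n ns h {t} as j≢i len =
  trans (inflowFrom-∷ (hub j) i n ns h as len)
        (cong (_+ inflowFrom (hub j) (suc i) ns as) (inflow-zero _≟SV_ (starArcs (h ∷ t)) (starEdges-avoid n (hub-outside j≢i))))

hubs-balanced : ∀ {i ns Hs} → Chunks ns Hs → All Balanced Hs → ∀ j →
  inflowFrom (hub j) i ns (snowArcs Hs) ≡ inflowFrom (hub j) i ns (snowArcs (map (map reverseArc) Hs))
hubs-balanced [] [] j = refl
hubs-balanced {i} {n ∷ ns} {(h ∷ t) ∷ Hs} (len ∷ chunks) (balanced H-bal ∷ bals) j = by-cases (j ≟ i)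
  where
  As = snowArcs Hs
  As′ = snowArcs (map (map reverseArc) Hs)
  len′ = trans (length-map reverseArc t) len
  by-cases : Dec (j ≡ i) → inflowFrom (hub j) i (n ∷ ns) (snowArcs ((h ∷ t) ∷ Hs)) ≡
                           inflowFrom (hub j) i (n ∷ ns) (snowArcs (map (map reverseArc) ((h ∷ t) ∷ Hs)))
  by-cases (yes refl) = trans (inflowFrom-ownHub i n ns h As len) (trans H-bal (sym (inflowFrom-ownHub i n ns (reverseArc h) As′ len′)))
  by-cases (no  j≢i)  = trans (inflowFrom-otherHub n ns h As j≢i len)
                        (trans (hubs-balanced chunks bals j) (sym (inflowFrom-otherHub n ns (reverseArc h) As′ j≢i len′)))

stars-balanced : ∀ {i ns Hs} → Chunks ns Hs →
  (∀ j → i ≤ j → j < i + length ns →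
     inflowFrom (hub j) i ns (snowArcs Hs) ≡ inflowFrom (hub j) i ns (snowArcs (map (map reverseArc) Hs))) →
  All Balanced Hs
stars-balanced [] hubs-bal = []
stars-balanced {i} {n ∷ ns} {(h ∷ t) ∷ Hs} (len ∷ chunks) hubs-bal =
  balanced (trans (sym (inflowFrom-ownHub i n ns h As len))
           (trans (hubs-bal i ≤-refl (m<m+n i (s≤s z≤n))) (inflowFrom-ownHub i n ns (reverseArc h) As′ len′)))
  ∷ stars-balanced chunks λ j i<j j<i+1+p →
      trans (sym (inflowFrom-otherHub n ns h As (≢-sym (<⇒≢ i<j)) len))
      (trans (hubs-bal j (<⇒≤ i<j) (subst (j <_) (sym (+-suc i (length ns))) j<i+1+p))
             (inflowFrom-otherHub n ns (reverseArc h) As′ (≢-sym (<⇒≢ i<j)) len′))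
  where
  As = snowArcs Hs
  As′ = snowArcs (map (map reverseArc) Hs)
  len′ = trans (length-map reverseArc t) len

center-inflow : ∀ {i ns Hs} → Chunks ns Hs → inflowFrom center i ns (snowArcs Hs) ≡ inwardSum (map reverseArc (heads Hs))
center-inflow [] = refl
center-inflow {i} {n ∷ ns} {(h ∷ t) ∷ Hs} (len ∷ chunks) =
  trans (inflowFrom-∷ center i n ns h (snowArcs Hs) len) (cong₂ _+_ (starInflow-center i n h t) (center-inflow chunks))

heads-reverse : ∀ Hs → heads (map (map reverseArc) Hs) ≡ map reverseArc (heads Hs)
heads-reverse []             = refl
heads-reverse ([] ∷ Hs)      = heads-reverse Hs
heads-reverse ((h ∷ t) ∷ Hs) = cong (reverseArc h ∷_) (heads-reverse Hs)

labels-snowArcs : ∀ Hs → map proj₂ (snowArcs Hs) ≡ concat (map (map proj₂) Hs)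
labels-snowArcs []             = refl
labels-snowArcs ([] ∷ Hs)      = labels-snowArcs Hs
labels-snowArcs ((h ∷ t) ∷ Hs) = trans (map-++ proj₂ (starArcs (h ∷ t)) (snowArcs Hs))
  (cong₂ (λ ls ls′ → proj₂ h ∷ ls ++ ls′) (map-proj₂-reverseArc t) (labels-snowArcs Hs))

sum-labels-balanced : ∀ {Hs} → All Balanced Hs → sum (concat (map (map proj₂) Hs)) ≡ 2 * sum (map inwardSum Hs)
sum-labels-balanced [] = refl
sum-labels-balanced {H ∷ Hs} (balanced H-bal ∷ bals) = begin
  sum (map proj₂ H ++ concat (map (map proj₂) Hs))           ≡⟨ sum-++ (map proj₂ H) _ ⟩
  sum (map proj₂ H) + sum (concat (map (map proj₂) Hs))       ≡⟨ cong₂ _+_ (sum-labels-split H) (sum-labels-balanced bals) ⟩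
  inwardSum H + inwardSum (map reverseArc H) + 2 * sum (map inwardSum Hs) ≡⟨ cong (λ x → inwardSum H + x + _) H-bal ⟨
  inwardSum H + inwardSum H + 2 * sum (map inwardSum Hs)     ≡⟨ arithmetic (inwardSum H) _ ⟩
  2 * (inwardSum H + sum (map inwardSum Hs)) ∎
  where
  open ≡-Reasoning
  arithmetic : ∀ x y → x + x + 2 * y ≡ 2 * (x + y)
  arithmetic = solve-∀

length-snowEdges : ∀ i ss → length (snowEdgesFrom i (map size ss)) ≡ totalSize ss
length-snowEdges i []       = refl
length-snowEdges i (s ∷ ss) =
  trans (length-++ (starEdges i (size s))) (cong₂ _+_ (length-starEdges i (size s)) (length-snowEdges (suc i) ss))

private
  length-edges : ∀ i n ns → length (snowEdgesFrom i (n ∷ ns)) ≡ suc (n ∸ 1 + length (snowEdgesFrom (suc i) ns))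
  length-edges i n ns = trans (length-++ (starEdges i n)) (cong (_+ length (snowEdgesFrom (suc i) ns)) (length-starEdges i n))

chunk : ∀ i ns as → length as ≡ length (snowEdgesFrom i ns) → ∃ λ Hs → Chunks ns Hs × snowArcs Hs ≡ as
chunk i []       []       _  = [] , [] , refl
chunk i (n ∷ ns) []       eq with () ← trans eq (length-edges i n ns)
chunk i (n ∷ ns) (h ∷ as) eq =
  let (Hs , chunks , snowArcs-Hs) = chunk (suc i) ns (drop (n ∸ 1) as) length-rest
  in (h ∷ map reverseArc (take (n ∸ 1) as)) ∷ Hs ,
     trans (length-map reverseArc (take (n ∸ 1) as)) length-star ∷ chunks ,
     cong (h ∷_) (trans (cong₂ _++_ (map-reverseArc-involutive _) snowArcs-Hs) (take++drop≡id (n ∸ 1) as))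
  where
  length-as : length as ≡ n ∸ 1 + length (snowEdgesFrom (suc i) ns)
  length-as = suc-injective (trans eq (length-edges i n ns))
  length-star : length (take (n ∸ 1) as) ≡ n ∸ 1
  length-star = trans (length-take (n ∸ 1) as) (m≤n⇒m⊓n≡m (subst (n ∸ 1 ≤_) (sym length-as) (m≤m+n _ _)))
  length-rest : length (drop (n ∸ 1) as) ≡ length (snowEdgesFrom (suc i) ns)
  length-rest = trans (length-drop (n ∸ 1) as) (trans (cong (_∸ (n ∸ 1)) length-as) (m+n∸m≡n (n ∸ 1) _))

length-snowArcs : ∀ {i ns Hs} → Chunks ns Hs → length (snowArcs Hs) ≡ length (snowEdgesFrom i ns)
length-snowArcs [] = refl
length-snowArcs {i} {n ∷ ns} {(h ∷ t) ∷ Hs} (len ∷ chunks) = begin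
  suc (length (map reverseArc t ++ snowArcs Hs))       ≡⟨ cong suc (length-++ (map reverseArc t)) ⟩
  suc (length (map reverseArc t) + length (snowArcs Hs))
    ≡⟨ cong₂ (λ x y → suc (x + y)) (trans (length-map reverseArc t) len) (length-snowArcs chunks) ⟩
  suc (n ∸ 1 + length (snowEdgesFrom (suc i) ns))      ≡⟨ length-edges i n ns ⟨
  length (snowEdgesFrom i (n ∷ ns)) ∎
  where open ≡-Reasoning

degreeFrom : SV → ℕ → List ℕ → ℕ
degreeFrom u i ns = sum (map (incidence _≟SV_ u) (snowEdgesFrom i ns))

starDegree : SV → ℕ → ℕ → ℕ
starDegree u i n = sum (map (incidence _≟SV_ u) (starEdges i n))

degreeFrom-∷ : ∀ u i n ns → degreeFrom u i (n ∷ ns) ≡ starDegree u i n + degreeFrom u (suc i) ns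
degreeFrom-∷ u i n ns =
  trans (cong sum (map-++ (incidence _≟SV_ u) (starEdges i n) _)) (sum-++ (map (incidence _≟SV_ u) (starEdges i n)) _)

center-degree : ∀ i ns → degreeFrom center i ns ≡ length ns
center-degree i []       = refl
center-degree i (n ∷ ns) = trans (degreeFrom-∷ center i n ns)
  (cong₂ (λ x y → suc (x + y)) (incidence-zero _≟SV_ {center} (leafEdges i (n ∸ 1) (λ t → (λ ()) , (λ ()))))
                               (center-degree (suc i) ns))

starDegree-ownHub : ∀ i n → starDegree (hub i) i n ≡ suc (n ∸ 1)
starDegree-ownHub i n rewrite does-refl (hub i) =
  cong suc (trans (sum-map-const _ 1 (leafEdges i (n ∸ 1) leaf-edge))
    (trans (*-identityʳ _) (trans (length-map _ (upTo (n ∸ 1))) (length-upTo (n ∸ 1)))))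
  where
  leaf-edge : ∀ t → incidence _≟SV_ (hub i) (hub i , leaf i t) ≡ 1
  leaf-edge t rewrite does-refl (hub i) = refl

laterStars-degree : ∀ {u} i ns → (∀ {s} → i ≤ s → OutsideStar u s) → degreeFrom u i ns ≡ 0
laterStars-degree i ns outside = incidence-zero _≟SV_ (snowEdges-avoid ns outside)

degreeFrom-ownHub : ∀ i n ns → degreeFrom (hub i) i (n ∷ ns) ≡ suc (n ∸ 1)
degreeFrom-ownHub i n ns =
  trans (degreeFrom-∷ (hub i) i n ns)
        (trans (cong₂ _+_ (starDegree-ownHub i n) (laterStars-degree (suc i) ns (hub-outside ∘ <⇒≢))) (+-identityʳ _))

degreeFrom-outside : ∀ {u} i n ns → OutsideStar u i → degreeFrom u i (n ∷ ns) ≡ degreeFrom u (suc i) ns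
degreeFrom-outside {u} i n ns outside =
  trans (degreeFrom-∷ u i n ns) (cong (_+ degreeFrom u (suc i) ns) (incidence-zero _≟SV_ (starEdges-avoid n outside)))

private
  suc-∸1 : ∀ {n m} → suc m ≤ n → suc (n ∸ 1) ≡ n
  suc-∸1 (s≤s _) = refl

  n≤suc[n∸1] : ∀ n → n ≤ suc (n ∸ 1)
  n≤suc[n∸1] zero    = z≤n
  n≤suc[n∸1] (suc n) = ≤-refl

hub-degree-≥ : ∀ {m i j ns} → All (m ≤_) ns → i ≤ j → j < i + length ns → m ≤ degreeFrom (hub j) i ns
hub-degree-≥ {i = i} {j} {[]} [] i≤j j<i+0 = ⊥-elim (<⇒≱ j<i+0 (subst (_≤ j) (sym (+-identityʳ i)) i≤j))
hub-degree-≥ {m} {i} {j} {n ∷ ns} (m≤n ∷ m≤ns) i≤j j<i+1+p = by-cases (j ≟ i)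
  where
  by-cases : Dec (j ≡ i) → m ≤ degreeFrom (hub j) i (n ∷ ns)
  by-cases (yes refl) = ≤-trans m≤n (≤-trans (n≤suc[n∸1] n) (≤-reflexive (sym (degreeFrom-ownHub i n ns))))
  by-cases (no  j≢i)  = subst (m ≤_) (sym (degreeFrom-outside i n ns (hub-outside j≢i)))
    (hub-degree-≥ m≤ns (≤∧≢⇒< i≤j (j≢i ∘ sym)) (subst (j <_) (+-suc i (length ns)) j<i+1+p))

hub-degree-even : ∀ {i ns} → All (2 ≤_) ns → (∀ j → 2 ≤ degreeFrom (hub j) i ns → 2 ∣ degreeFrom (hub j) i ns) →
  All (2 ∣_) ns
hub-degree-even                 []           even = []
hub-degree-even {i} {n ∷ ns} (2≤n ∷ 2≤ns) even = own ∷ hub-degree-even 2≤ns later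
  where
  degree-own : degreeFrom (hub i) i (n ∷ ns) ≡ n
  degree-own = trans (degreeFrom-ownHub i n ns) (suc-∸1 2≤n)
  own : 2 ∣ n
  own = subst (2 ∣_) degree-own (even i (subst (2 ≤_) (sym degree-own) 2≤n))
  later : ∀ j → 2 ≤ degreeFrom (hub j) (suc i) ns → 2 ∣ degreeFrom (hub j) (suc i) ns
  later j 2≤deg with j ≟ i
  ... | yes refl = ⊥-elim (<⇒≱ (s≤s z≤n) (subst (2 ≤_) (laterStars-degree (suc i) ns (hub-outside ∘ <⇒≢)) 2≤deg))
  ... | no  j≢i  = subst (2 ∣_) deg≡ (even j (subst (2 ≤_) (sym deg≡) 2≤deg))
    where
    deg≡ : degreeFrom (hub j) i (n ∷ ns) ≡ degreeFrom (hub j) (suc i) ns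
    deg≡ = degreeFrom-outside i n ns (hub-outside j≢i)

starDegree-ownLeaf : ∀ i n b → starDegree (leaf i b) i n ≤ 1
starDegree-ownLeaf i n b =
  subst (_≤ 1) (cong sum (map-∘ (upTo (n ∸ 1)))) (sum-map-single leaf-edge b (unique-upTo⁺ (n ∸ 1)) leaf-edge≡0 leaf-edge≤1)
  where
  leaf-edge : ℕ → ℕ
  leaf-edge t = incidence _≟SV_ (leaf i b) (hub i , leaf i t)
  leaf-edge≡0 : ∀ t → t ≢ b → leaf-edge t ≡ 0
  leaf-edge≡0 t t≢b rewrite dec-false (leaf i b ≟SV leaf i t) (t≢b ∘ sym ∘ leaf-inj₂) = refl
  leaf-edge≤1 : leaf-edge b ≤ 1
  leaf-edge≤1 rewrite does-refl (leaf i b) = ≤-refl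

leaf-degree : ∀ a b i ns → degreeFrom (leaf a b) i ns ≤ 1
leaf-degree a b i []       = z≤n
leaf-degree a b i (n ∷ ns) = by-cases (a ≟ i)
  where
  by-cases : Dec (a ≡ i) → degreeFrom (leaf a b) i (n ∷ ns) ≤ 1
  by-cases (yes refl) = subst (_≤ 1) (sym own-star) (starDegree-ownLeaf a n b)
    where
    own-star : degreeFrom (leaf a b) a (n ∷ ns) ≡ starDegree (leaf a b) a n
    own-star = trans (degreeFrom-∷ (leaf a b) a n ns)
      (trans (cong (starDegree (leaf a b) a n +_) (laterStars-degree (suc a) ns (leaf-outside ∘ <⇒≢))) (+-identityʳ _))
  by-cases (no  a≢i)  = subst (_≤ 1) (sym (degreeFrom-outside i n ns (leaf-outside a≢i))) (leaf-degree a b (suc i) ns)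

-- Balancing the center

next : Shape → ℕ → ℕ
next s b = size s + b

after : ℕ → List Shape → ℕ
after b []       = b
after b (s ∷ ss) = after (next s b) ss

data Admissible : Bool → ℕ → List Shape → List Arc → Set where
  []  : ∀ {c b} → Admissible c b [] []
  _∷_ : ∀ {c b s ss σ h hs} → h ∈ starValues c (c xor proj₁ s) b (size s) →
        Admissible (c xor proj₁ s) (next s b) ss hs → Admissible c b (s ∷ ss) ((σ , h) ∷ hs)

assemble : ∀ {c b ss hs} → Admissible c b ss hs →
  ∃ λ Hs → Chunks (map size ss) Hs × All Balanced Hs × heads Hs ≡ hs × concat (map (map proj₂) Hs) ↭ chainValues c b ss
assemble [] = [] , [] , [] , refl , ↭-refl
assemble {c} {b} {s ∷ ss} {(σ , h) ∷ hs} (h∈ ∷ admissible) =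
  let (t , star-bal , star-values) = star c s b σ h∈
      (Hs , chunks , bals , heads≡ , values) = assemble admissible
      length-t = suc-injective (trans (cong suc (sym (length-map proj₂ t)))
                   (trans (↭-length star-values) (length-starValues c (c xor proj₁ s) b (2 + extra s))))
  in ((σ , h) ∷ t) ∷ Hs , length-t ∷ chunks , star-bal ∷ bals , cong ((σ , h) ∷_) heads≡ , ↭-++⁺ star-values values

-- low and high are the extreme heads of a block admissible whatever the carries; across a block
-- boundary they differ by 3: low (next s b) = 3 + high s b.
low : ℕ → ℕ
low b = 2 + b

high : Shape → ℕ → ℕ
high s b = 3 + extra s + b

inner-admissible : ∀ c c′ s b k → k < 2 + extra s → 2 + (k + b) ∈ starValues c c′ b (size s)
inner-admissible c c′ s b k k<2+e = there (∈-++⁺ˡ (∈-range⁺ (s≤s (s≤s (m≤n+m b k))) (s≤s (s≤s k+b<b+2+e))))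
  where
  k+b<b+2+e : k + b < b + (2 + extra s)
  k+b<b+2+e = subst (k + b <_) (+-comm (2 + extra s) b) (+-monoˡ-< b k<2+e)

low-admissible : ∀ c c′ s b → low b ∈ starValues c c′ b (size s)
low-admissible c c′ s b = inner-admissible c c′ s b 0 (s≤s z≤n)

high-admissible : ∀ c c′ s b → high s b ∈ starValues c c′ b (size s)
high-admissible c c′ s b = inner-admissible c c′ s b (1 + extra s) ≤-refl

first-admissible : ∀ c′ s → suc (extra s) ∈ starValues false c′ 0 (size s)
first-admissible c′ s with extra s
... | zero  = here refl
... | suc e = there (∈-++⁺ˡ (∈-range⁺ (s≤s (s≤s z≤n)) (m≤n+m (3 + e) 2)))

quartet : ℕ → Shape → Shape → Shape → List Arc
quartet b s₀ s₁ s₂ =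
  (true , high s₀ b) ∷ (false , low (after b (s₀ ∷ []))) ∷ (false , high s₂ b₂) ∷ (true , low (next s₂ b₂)) ∷ []
  where b₂ = after b (s₀ ∷ s₁ ∷ [])

quartet-balanced : ∀ b s₀ s₁ s₂ → Balanced (quartet b s₀ s₁ s₂)
quartet-balanced b s₀ s₁ s₂ = balanced (arithmetic (high s₀ b) (high s₂ (after b (s₀ ∷ s₁ ∷ []))))
  where
  arithmetic : ∀ x y → x + (3 + y + 0) ≡ 3 + x + (y + 0)
  arithmetic = solve-∀

quartets : ℕ → List Shape → List Arc
quartets b (s₀ ∷ s₁ ∷ s₂ ∷ s₃ ∷ ss) = quartet b s₀ s₁ s₂ ++ quartets (after b (s₀ ∷ s₁ ∷ s₂ ∷ s₃ ∷ [])) ss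
quartets b (s ∷ ss)                 = (true , low b) ∷ quartets (next s b) ss
quartets b []                       = []

quartets-admissible : ∀ c b ss → Admissible c b ss (quartets b ss)
quartets-admissible c b (s₀ ∷ s₁ ∷ s₂ ∷ s₃ ∷ ss) =
  high-admissible _ _ s₀ b ∷ low-admissible _ _ s₁ _ ∷ high-admissible _ _ s₂ _ ∷ low-admissible _ _ s₃ _ ∷
  quartets-admissible _ _ ss
quartets-admissible c b (s ∷ [])            = low-admissible _ _ s b ∷ []
quartets-admissible c b (s₀ ∷ s₁ ∷ [])      = low-admissible _ _ s₀ b ∷ low-admissible _ _ s₁ _ ∷ []
quartets-admissible c b (s₀ ∷ s₁ ∷ s₂ ∷ []) =
  low-admissible _ _ s₀ b ∷ low-admissible _ _ s₁ _ ∷ low-admissible _ _ s₂ _ ∷ []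
quartets-admissible c b []                  = []

data Fours {A : Set} : List A → Set where
  []   : Fours []
  more : ∀ {a b c d xs} → Fours xs → Fours (a ∷ b ∷ c ∷ d ∷ xs)

quartets-balanced : ∀ {ss} → Fours ss → ∀ b → Balanced (quartets b ss)
quartets-balanced []                                      b = balanced refl
quartets-balanced (more {s₀} {s₁} {s₂} {s₃} {ss} fours) b =
  Balanced-++ (quartet-balanced b s₀ s₁ s₂) (quartets-balanced fours _)

prefix₃ : Shape → Shape → Shape → List Arc
prefix₃ s₀ s₁ s₂ = (true , 3) ∷ (true , high s₁ b₁) ∷ (false , low (next s₁ b₁)) ∷ []
  where b₁ = after 0 (s₀ ∷ [])

prefix₅ : Shape → Shape → Shape → Shape → Shape → List Arc
prefix₅ s₀ s₁ s₂ s₃ s₄ =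
  (false , 2) ∷ (true , high s₁ b₁) ∷ (false , low (next s₁ b₁)) ∷
  (false , 2 + extra s₃ + b₃) ∷ (true , 3 + next s₃ b₃) ∷ []
  where
  b₁ = after 0 (s₀ ∷ [])
  b₃ = after 0 (s₀ ∷ s₁ ∷ s₂ ∷ [])

prefix₆ : Shape → Shape → Shape → Shape → Shape → Shape → List Arc
prefix₆ s₀ s₁ s₂ s₃ s₄ s₅ =
  (true , suc (extra s₀)) ∷ (false , 3 + after 0 (s₀ ∷ [])) ∷
  (false , high s₂ b₂) ∷ (true , low (next s₂ b₂)) ∷ (false , high s₄ b₄) ∷ (true , low (next s₄ b₄)) ∷ []
  where
  b₂ = after 0 (s₀ ∷ s₁ ∷ [])
  b₄ = after 0 (s₀ ∷ s₁ ∷ s₂ ∷ s₃ ∷ [])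

prefix₃-balanced : ∀ s₀ s₁ s₂ → Balanced (prefix₃ s₀ s₁ s₂)
prefix₃-balanced s₀ s₁ s₂ = balanced refl

prefix₅-balanced : ∀ s₀ s₁ s₂ s₃ s₄ → Balanced (prefix₅ s₀ s₁ s₂ s₃ s₄)
prefix₅-balanced s₀ s₁ s₂ s₃ s₄ =
  balanced (arithmetic (high s₁ (after 0 (s₀ ∷ []))) (2 + extra s₃ + after 0 (s₀ ∷ s₁ ∷ s₂ ∷ [])))
  where
  arithmetic : ∀ x z → x + (5 + z + 0) ≡ 2 + (3 + x + (z + 0))
  arithmetic = solve-∀

prefix₆-balanced : ∀ s₀ s₁ s₂ s₃ s₄ s₅ → Balanced (prefix₆ s₀ s₁ s₂ s₃ s₄ s₅)
prefix₆-balanced s₀ s₁ s₂ s₃ s₄ s₅ =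
  balanced (arithmetic (extra s₀) (high s₂ (after 0 (s₀ ∷ s₁ ∷ [])))
                                  (high s₄ (after 0 (s₀ ∷ s₁ ∷ s₂ ∷ s₃ ∷ []))))
  where
  arithmetic : ∀ e x y → suc e + (3 + x + (3 + y + 0)) ≡ 3 + (4 + e + 0) + (x + (y + 0))
  arithmetic = solve-∀

data Remainder {A : Set} : List A → Set where
  none  : ∀ {xs} → Fours xs → Remainder xs
  three : ∀ {a b c xs} → Fours xs → Remainder (a ∷ b ∷ c ∷ xs)
  five  : ∀ {a b c d e xs} → Fours xs → Remainder (a ∷ b ∷ c ∷ d ∷ e ∷ xs)
  six   : ∀ {a b c d e f xs} → Fours xs → Remainder (a ∷ b ∷ c ∷ d ∷ e ∷ f ∷ xs)
  short : ∀ {xs} → length xs < 3 → Remainder xs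

remainder : ∀ {A : Set} (xs : List A) → Remainder xs
remainder []                    = none []
remainder (_ ∷ [])              = short (s≤s (s≤s z≤n))
remainder (_ ∷ _ ∷ [])          = short (s≤s (s≤s (s≤s z≤n)))
remainder (_ ∷ _ ∷ _ ∷ [])      = three []
remainder (_ ∷ _ ∷ _ ∷ _ ∷ xs) with remainder xs
... | none  fours = none  (more fours)
... | three fours = three (more fours)
... | five  fours = five  (more fours)
... | six   fours = six   (more fours)
... | short {[]}              _ = none (more [])
... | short {_ ∷ []}          _ = five []
... | short {_ ∷ _ ∷ []}      _ = six []
... | short {_ ∷ _ ∷ _ ∷ _} (s≤s (s≤s (s≤s ())))

-- Fewer than three stars leave the center unconstrained.
plan : ∀ {ss} → Remainder ss → List Arc
plan {ss}                               (none _)  = quartets 0 ss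
plan {s₀ ∷ s₁ ∷ s₂ ∷ ss}                (three _) = prefix₃ s₀ s₁ s₂ ++ quartets (after 0 (s₀ ∷ s₁ ∷ s₂ ∷ [])) ss
plan {s₀ ∷ s₁ ∷ s₂ ∷ s₃ ∷ s₄ ∷ ss}      (five _)  =
  prefix₅ s₀ s₁ s₂ s₃ s₄ ++ quartets (after 0 (s₀ ∷ s₁ ∷ s₂ ∷ s₃ ∷ s₄ ∷ [])) ss
plan {s₀ ∷ s₁ ∷ s₂ ∷ s₃ ∷ s₄ ∷ s₅ ∷ ss} (six _)   =
  prefix₆ s₀ s₁ s₂ s₃ s₄ s₅ ++ quartets (after 0 (s₀ ∷ s₁ ∷ s₂ ∷ s₃ ∷ s₄ ∷ s₅ ∷ [])) ss
plan {ss}                               (short _) = quartets 0 ss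

plan-admissible : ∀ {ss} (r : Remainder ss) → Admissible false 0 ss (plan r)
plan-admissible {ss} (none _) = quartets-admissible false 0 ss
plan-admissible {s₀ ∷ s₁ ∷ s₂ ∷ ss} (three _) =
  inner-admissible _ _ s₀ 0 1 (s≤s (s≤s z≤n)) ∷ high-admissible _ _ s₁ _ ∷ low-admissible _ _ s₂ _ ∷
  quartets-admissible _ _ ss
plan-admissible {s₀ ∷ s₁ ∷ s₂ ∷ s₃ ∷ s₄ ∷ ss} (five _) =
  low-admissible _ _ s₀ 0 ∷ high-admissible _ _ s₁ _ ∷ low-admissible _ _ s₂ _ ∷
  inner-admissible _ _ s₃ _ (extra s₃) (m<n+m _ (s≤s z≤n)) ∷ inner-admissible _ _ s₄ _ 1 (s≤s (s≤s z≤n)) ∷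
  quartets-admissible _ _ ss
plan-admissible {s₀ ∷ s₁ ∷ s₂ ∷ s₃ ∷ s₄ ∷ s₅ ∷ ss} (six _) =
  first-admissible _ s₀ ∷ inner-admissible _ _ s₁ _ 1 (s≤s (s≤s z≤n)) ∷
  high-admissible _ _ s₂ _ ∷ low-admissible _ _ s₃ _ ∷ high-admissible _ _ s₄ _ ∷ low-admissible _ _ s₅ _ ∷
  quartets-admissible _ _ ss
plan-admissible {ss} (short _) = quartets-admissible false 0 ss

plan-balanced : ∀ {ss} (r : Remainder ss) → 3 ≤ length ss → Balanced (plan r)
plan-balanced (none fours) _ = quartets-balanced fours 0
plan-balanced {s₀ ∷ s₁ ∷ s₂ ∷ ss} (three fours) _ =
  Balanced-++ (prefix₃-balanced s₀ s₁ s₂) (quartets-balanced fours _)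
plan-balanced {s₀ ∷ s₁ ∷ s₂ ∷ s₃ ∷ s₄ ∷ ss} (five fours) _ =
  Balanced-++ (prefix₅-balanced s₀ s₁ s₂ s₃ s₄) (quartets-balanced fours _)
plan-balanced {s₀ ∷ s₁ ∷ s₂ ∷ s₃ ∷ s₄ ∷ s₅ ∷ ss} (six fours) _ =
  Balanced-++ (prefix₆-balanced s₀ s₁ s₂ s₃ s₄ s₅) (quartets-balanced fours _)
plan-balanced (short p<3) 3≤p = ⊥-elim (<⇒≱ p<3 3≤p)

zero-net : ∀ {x y} → x ≡ y → ℤ.+ x - ℤ.+ y ≡ ℤ.+ 0
zero-net {x} refl = ℤ.i≡j⇒i-j≡0 {ℤ.+ x} refl

snowflake-zeroSums : ∀ {ns Hs} → Chunks ns Hs → All Balanced Hs → (3 ≤ length ns → Balanced (heads Hs)) →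
  ∀ u → 3 ≤ degreeFrom u 0 ns →
  ℤ.+ inflowFrom u 0 ns (snowArcs Hs) - ℤ.+ inflowFrom u 0 ns (map reverseArc (snowArcs Hs)) ≡ ℤ.+ 0
snowflake-zeroSums {ns} {Hs} chunks bals heads-bal center 3≤deg = zero-net (begin
  inflowFrom center 0 ns (snowArcs Hs)                        ≡⟨ center-inflow chunks ⟩
  inwardSum (map reverseArc (heads Hs))                        ≡⟨ balance (heads-bal (subst (3 ≤_) (center-degree 0 ns) 3≤deg)) ⟨
  inwardSum (heads Hs)                                         ≡⟨ cong inwardSum (map-reverseArc-involutive (heads Hs)) ⟨
  inwardSum (map reverseArc (map reverseArc (heads Hs)))      ≡⟨ cong (inwardSum ∘ map reverseArc) (heads-reverse Hs) ⟨
  inwardSum (map reverseArc (heads (map (map reverseArc) Hs))) ≡⟨ center-inflow (Chunks-reverse chunks) ⟨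
  inflowFrom center 0 ns (snowArcs (map (map reverseArc) Hs)) ≡⟨ cong (inflowFrom center 0 ns) (snowArcs-reverse Hs) ⟨
  inflowFrom center 0 ns (map reverseArc (snowArcs Hs)) ∎)
  where open ≡-Reasoning
snowflake-zeroSums {ns} {Hs} chunks bals heads-bal (hub j) _ =
  zero-net (trans (hubs-balanced chunks bals j) (cong (inflowFrom (hub j) 0 ns) (sym (snowArcs-reverse Hs))))
snowflake-zeroSums {ns} chunks bals heads-bal (leaf a b) 3≤deg =
  ⊥-elim (<⇒≱ (s≤s (m≤n⇒m≤1+n (leaf-degree a b 0 ns))) 3≤deg)

snowflake-labeling : ∀ s ss {S T} → Enumerates S T →
  starValues false (carry false (s ∷ ss)) 0 (Graph.M (snowflake (map size (s ∷ ss)))) ↭ T →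
  Graph.ZeroSumLabeling (snowflake (map size (s ∷ ss))) S
snowflake-labeling s ss {S} {T} enumeration values↭T = o , lab , ↭⇒labelingOnto G enumeration labels↭T , zeroSums
  where
  G = snowflake (map size (s ∷ ss))
  r = remainder (s ∷ ss)
  construction = assemble (plan-admissible r)
  Hs = proj₁ construction
  chunks = proj₁ (proj₂ construction)
  bals = proj₁ (proj₂ (proj₂ construction))
  heads≡plan = proj₁ (proj₂ (proj₂ (proj₂ construction)))
  values = proj₂ (proj₂ (proj₂ (proj₂ construction)))
  M≡ : Graph.M G ≡ length (snowArcs Hs)
  M≡ = sym (length-snowArcs chunks)
  o : Graph.Orientation G
  o = proj₁ ∘ lookup (snowArcs Hs) ∘ cast M≡
  lab : Graph.Edge G → ℕ
  lab = proj₂ ∘ lookup (snowArcs Hs) ∘ cast M≡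
  arcs≡ : arcsOf G o lab ≡ snowArcs Hs
  arcs≡ = arcsOf-lookup G (snowArcs Hs) M≡
  labels↭T : tabulate lab ↭ T
  labels↭T = begin
    tabulate lab                                          ≡⟨ map-tabulate (λ e → o e , lab e) proj₂ ⟨
    map proj₂ (arcsOf G o lab)                            ≡⟨ cong (map proj₂) arcs≡ ⟩
    map proj₂ (snowArcs Hs)                               ≡⟨ labels-snowArcs Hs ⟩
    concat (map (map proj₂) Hs)                           ↭⟨ values ⟩
    chainValues false 0 (s ∷ ss)                          ↭⟨ chainValues-↭ false 0 s ss ⟩
    starValues false (carry false (s ∷ ss)) 0 (totalSize (s ∷ ss))
      ≡⟨ cong (starValues false (carry false (s ∷ ss)) 0) (length-snowEdges 0 (s ∷ ss)) ⟨
    starValues false (carry false (s ∷ ss)) 0 (Graph.M G) ↭⟨ values↭T ⟩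
    T ∎
    where open PermutationReasoning
  heads-balanced : 3 ≤ length (map size (s ∷ ss)) → Balanced (heads Hs)
  heads-balanced 3≤p = subst Balanced (sym heads≡plan) (plan-balanced r (subst (3 ≤_) (length-map size (s ∷ ss)) 3≤p))
  zeroSums : ∀ u → 3 ≤ Graph.deg G u → Graph.vertexSum G o lab u ≡ ℤ.+ 0
  zeroSums u 3≤deg = trans (vertexSum-inflow G o lab u)
    (trans (cong (λ as → ℤ.+ inflowAt G u as - ℤ.+ inflowAt G u (map reverseArc as)) arcs≡)
           (snowflake-zeroSums chunks bals heads-balanced u (subst (3 ≤_) (deg-incidence G u) 3≤deg)))

conservative⇒even-sum : ∀ {ns} → All (3 ≤_) ns → Graph.Conservative (snowflake ns) →
  ∃ λ X → sum (range 1 (Graph.M (snowflake ns))) ≡ 2 * X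
conservative⇒even-sum {ns} 3≤ns (o , lab , onto , zeroSums) = sum (map inwardSum Hs) , (begin
  sum (range 1 (Graph.M G))            ≡⟨ sum-↭ (labelingOnto⇒↭ G (consLabels-enumeration (Graph.M G)) onto) ⟨
  sum (tabulate lab)                   ≡⟨ cong sum (map-tabulate (λ e → o e , lab e) proj₂) ⟨
  sum (map proj₂ A)                    ≡⟨ cong (sum ∘ map proj₂) snowArcs≡A ⟨
  sum (map proj₂ (snowArcs Hs))        ≡⟨ cong sum (labels-snowArcs Hs) ⟩
  sum (concat (map (map proj₂) Hs))    ≡⟨ sum-labels-balanced bals ⟩
  2 * sum (map inwardSum Hs)           ∎)
  where
  open ≡-Reasoning
  G = snowflake ns
  A = arcsOf G o lab
  chunking = chunk 0 ns A (length-tabulate (λ e → o e , lab e))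
  Hs = proj₁ chunking
  chunks = proj₁ (proj₂ chunking)
  snowArcs≡A = proj₂ (proj₂ chunking)
  hub-balanced : ∀ j → 0 ≤ j → j < length ns →
    inflowFrom (hub j) 0 ns (snowArcs Hs) ≡ inflowFrom (hub j) 0 ns (snowArcs (map (map reverseArc) Hs))
  hub-balanced j _ j<p = begin
    inflowFrom (hub j) 0 ns (snowArcs Hs)                          ≡⟨ cong (inflowFrom (hub j) 0 ns) snowArcs≡A ⟩
    inflowFrom (hub j) 0 ns A                                      ≡⟨ ℤ.+-injective (ℤ.i-j≡0⇒i≡j _ _ net≡0) ⟩
    inflowFrom (hub j) 0 ns (map reverseArc A)                     ≡⟨ cong (inflowFrom (hub j) 0 ns ∘ map reverseArc) snowArcs≡A ⟨
    inflowFrom (hub j) 0 ns (map reverseArc (snowArcs Hs))         ≡⟨ cong (inflowFrom (hub j) 0 ns) (snowArcs-reverse Hs) ⟩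
    inflowFrom (hub j) 0 ns (snowArcs (map (map reverseArc) Hs)) ∎
    where
    net≡0 = trans (sym (vertexSum-inflow G o lab (hub j)))
                  (zeroSums (hub j) (subst (3 ≤_) (sym (deg-incidence G (hub j))) (hub-degree-≥ 3≤ns z≤n j<p)))
  bals : All Balanced Hs
  bals = stars-balanced chunks hub-balanced

snowflake-theorem : ∀ s ss → All (3 ≤_) (map size (s ∷ ss)) →
  (Graph.M (snowflake (map size (s ∷ ss))) % 4 ≡ 0 → Graph.Conservative (snowflake (map size (s ∷ ss)))) ×
  (Graph.M (snowflake (map size (s ∷ ss))) % 4 ≢ 0 → Graph.NearConservative (snowflake (map size (s ∷ ss))))
snowflake-theorem s ss 3≤ns with carry false (s ∷ ss) in carry≡ | totalSize-mod4 false (s ∷ ss)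
... | false | t , M≡ = (λ _ → conservative) , (λ M%4≢0 → ⊥-elim (M%4≢0 M%4≡0))
  where
  G = snowflake (map size (s ∷ ss))
  M≡t*4 : Graph.M G ≡ t * 4
  M≡t*4 = trans (length-snowEdges 0 (s ∷ ss)) (trans (sym (+-identityʳ _)) (trans M≡ (+-identityʳ _)))
  M%4≡0 : Graph.M G % 4 ≡ 0
  M%4≡0 = trans (cong (_% 4) M≡t*4) (m*n%n≡0 t 4)
  conservative : Graph.Conservative G
  conservative = snowflake-labeling s ss (consLabels-enumeration (Graph.M G))
    (↭-reflexive (trans (cong (λ c → starValues false c 0 (Graph.M G)) carry≡) (initialValues-conservative _)))
... | true  | t , M≡ = (λ M%4≡0 → ⊥-elim (M%4≢0 M%4≡0)) , (λ _ → not-conservative , near-conservative)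
  where
  G = snowflake (map size (s ∷ ss))
  M≡t*4+2 : Graph.M G ≡ t * 4 + 2
  M≡t*4+2 = trans (length-snowEdges 0 (s ∷ ss)) (trans (sym (+-identityʳ _)) M≡)
  M%4≢0 : Graph.M G % 4 ≢ 0
  M%4≢0 M%4≡0 = 0≢1+n (trans (sym M%4≡0) (trans (cong (_% 4) (trans M≡t*4+2 (+-comm (t * 4) 2))) ([m+kn]%n≡m%n 2 t 4)))
  not-conservative : ¬ Graph.Conservative G
  not-conservative conservative =
    let (X , sum≡2X) = conservative⇒even-sum 3≤ns conservative
    in sum-range-odd t X (trans (cong (sum ∘ range 1) (sym M≡t*4+2)) sum≡2X)
  near-conservative : Graph.ZeroSumLabeling G (Graph.NearLabels G)
  near-conservative = snowflake-labeling s ss (nearLabels-enumeration (Graph.M G))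
    (↭-trans (↭-reflexive (cong (λ c → starValues false c 0 (Graph.M G)) carry≡)) (initialValues-near _))

theorem29 : (ns : List ℕ) → IsSnowflakeData ns → IsEvenSnowflake ns →
    (Graph.M (snowflake ns) % 4 ≡ 0 → Graph.Conservative (snowflake ns)) ×
    (Graph.M (snowflake ns) % 4 ≢ 0 → Graph.NearConservative (snowflake ns))
theorem29 ns (1≤p , 3≤ns) even with shapes-of 3≤ns (hub-degree-even (All.map (≤-trans (n≤1+n 2)) 3≤ns) even-hubs)
  where
  even-hubs : ∀ j → 2 ≤ degreeFrom (hub j) 0 ns → 2 ∣ degreeFrom (hub j) 0 ns
  even-hubs j 2≤deg = subst (2 ∣_) (deg-incidence (snowflake ns) (hub j))
    (even (hub j) (λ ()) (subst (2 ≤_) (sym (deg-incidence (snowflake ns) (hub j))) 2≤deg))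
... | []     , refl = ⊥-elim (<-irrefl refl 1≤p)
... | s ∷ ss , refl = snowflake-theorem s ss 3≤ns
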